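{- For every integer $n\geq 1$ and every integer $r\geq 0$, the number of involutions in $\mathfrak{I}_n(132)$ having exactly $r$ rises is $$\binom{\lfloor n/2\rfloor}{\lfloor (r+1)/2\rfloor}\binom{\lfloor (n-1)/2\rfloor}{\lfloor r/2\rfloor}.$$
   Context: $\mathfrak{I}_n(132)$ is the set of involutions $\pi=\pi^{ -1}$ in the symmetric group $\mathfrak{S}_n$ (one-line notation $\pi_1\cdots\pi_n$) that avoid the pattern $132$, i.e. have no indices $i<j<k$ with $\pi_i<\pi_k<\pi_j$. A rise of $\pi$ is an index $1\leq j\leq n-1$ with $\pi_j<\pi_{j+1}$. $\lfloor\cdot\rfloor$ is the floor function, and $\binom{a}{b}=0$ if $b<0$ or $b>a$. -}

module Defs where

open import Data.Nat using (ℕ; zero; suc; _<_)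
open import Data.Nat.Properties using (_<?_)
open import Data.Fin using (Fin; toℕ)
open import Data.Fin.Properties using (all?; any?)
open import Data.Vec using (Vec; []; _∷_; lookup; toList)
open import Data.List using (List; []; _∷_; map; concatMap; length; filter; allFin)
open import Data.Product using (∃; _×_; _,_)
open import Relation.Nullary using (¬_; Dec; yes; no)
open import Relation.Nullary.Decidable using (_×-dec_; ¬?)
open import Relation.Binary.PropositionalEquality using (_≡_)
import Data.Fin as F

allVecs : (n k : ℕ) → List (Vec (Fin n) k)
allVecs n zero = [] ∷ []
allVecs n (suc k) = concatMap (λ x → map (x ∷_) (allVecs n k)) (allFin n)

-- A permutation-candidate in one-line notation: π = π₁ ⋯ πₙ, values in {0,…,n-1}.
-- Involution: π (π i) = i for all i (this forces π to be a bijection).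
IsInvolution : ∀ {n} → Vec (Fin n) n → Set
IsInvolution {n} π = ∀ (i : Fin n) → lookup π (lookup π i) ≡ i

Contains132 : ∀ {n} → Vec (Fin n) n → Set
Contains132 {n} π = ∃ λ (i : Fin n) → ∃ λ (j : Fin n) → ∃ λ (k : Fin n) →
  (i F.< j) × (j F.< k) × (lookup π i F.< lookup π k) × (lookup π k F.< lookup π j)

Avoids132 : ∀ {n} → Vec (Fin n) n → Set
Avoids132 π = ¬ Contains132 π

riseAt : ∀ {n} → Fin n → Fin n → ℕ
riseAt x y with toℕ x <? toℕ y
... | yes _ = 1
... | no _ = 0

risesFrom : ∀ {n} → Fin n → List (Fin n) → ℕ
risesFrom x [] = 0
risesFrom x (y ∷ xs) = riseAt x y Data.Nat.+ risesFrom y xs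

risesList : ∀ {n} → List (Fin n) → ℕ
risesList [] = 0
risesList (x ∷ xs) = risesFrom x xs

rises : ∀ {n} → Vec (Fin n) n → ℕ
rises π = risesList (Data.Vec.toList π)

isInvolution? : ∀ {n} (π : Vec (Fin n) n) → Dec (IsInvolution π)
isInvolution? {n} π = all? (λ i → lookup π (lookup π i) Data.Fin.≟ i)

contains132? : ∀ {n} (π : Vec (Fin n) n) → Dec (Contains132 π)
contains132? {n} π = any? λ i → any? λ j → any? λ k →
  (i F.<? j) ×-dec (j F.<? k) ×-dec (lookup π i F.<? lookup π k) ×-dec (lookup π k F.<? lookup π j)

Good : (n r : ℕ) → Vec (Fin n) n → Set
Good n r π = IsInvolution π × Avoids132 π × (rises π ≡ r)

good? : (n r : ℕ) (π : Vec (Fin n) n) → Dec (Good n r π)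
good? n r π = isInvolution? π ×-dec ¬? (contains132? π) ×-dec (rises π Data.Nat.≟ r)

countInv132Rises : (n r : ℕ) → ℕ
countInv132Rises n r = length (filter (good? n r) (allVecs n n))

-- A 132-avoiding involution π of {0, …, m+1} either fixes m+1, and removing that fixed
-- point leaves a 132-avoiding involution of {0, …, m}, or contains a 2-cycle (j, m+1) with j ≤ m.
-- In the second case π(j) = m+1 is the largest value, so every entry before position j exceeds every
-- entry after it; counting entries then shows 2j ≤ m and that removing the cycle leaves a
-- 132-avoiding involution σ of {0, …, m-1} exchanging its first j positions with its last j values.
-- Conversely every such j (including j = 0) gives back a 132-avoiding involution. Appending the fixed
-- point adds one rise, inserting the cycle at j = 0 adds none and at j > 0 adds two. If σ has v
-- admissible points j > 0, inserting at the k-th of them leaves v - k + 1 admissible points, and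
-- inserting at 0 leaves v + 1. Counting involutions by rises r and by a lower bound u on v gives
-- recurrences whose solution is C(⌊n/2⌋ - u, ⌊(r+1)/2⌋) C(⌊(n-1)/2⌋, ⌊r/2⌋); u = 0 is the theorem.

module Submission where

open import Defs
open import Data.Nat
open import Data.Nat.Properties
open import Data.Nat.Combinatorics using (_C_; nCk+nC[k+1]≡[n+1]C[k+1])
open import Data.Nat.DivMod using (m/n≡1+[m∸n]/n)
open import Data.Nat.Solver using (module +-*-Solver)
open import Data.Fin as Fin using (Fin; toℕ; fromℕ<)
open import Data.Fin.Properties using (toℕ<n; toℕ-fromℕ<; toℕ-injective; injective⇒≤)
open import Data.Vec using (Vec; []; _∷_; lookup; toList)
import Data.Vec.Properties as Vecₚ
open import Data.List
  using (List; []; _∷_; [_]; _++_; _∷ʳ_; map; take; drop; length; applyUpTo; upTo; filter; concatMap)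
open import Data.List.Properties
  using ( length-map; length-++; length-take; length-drop; length-applyUpTo; length-filter; ++-assoc; take++drop≡id
        ; ∷-injectiveˡ; ∷-injectiveʳ; ∷ʳ-injective; map-applyUpTo
        ; filter-accept; filter-reject; filter-all; filter-none; filter-some )
open import Data.List.Membership.Propositional using (_∈_; find)
open import Data.List.Membership.Propositional.Properties
  using ( ∈-map⁺; ∈-map⁻; ∈-++⁺ˡ; ∈-++⁺ʳ; ∈-++⁻; ∈-filter⁺; ∈-filter⁻; ∈-upTo⁺; ∈-upTo⁻; ∈-applyUpTo⁻
        ; ∈-concat⁺′; ∈-concat⁻; ∈-allFin )
open import Data.List.Membership.Propositional.Properties.WithK using (unique∧set⇒bag)
open import Data.List.Relation.Binary.BagAndSetEquality using (∼bag⇒↭)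
open import Data.List.Relation.Binary.Permutation.Propositional.Properties using (↭-length)
open import Data.List.Relation.Binary.Disjoint.Propositional using (Disjoint)
open import Data.List.Relation.Unary.Any as Any using (here; there)
import Data.List.Relation.Unary.Any.Properties as Anyₚ
open import Data.List.Relation.Unary.All as All using (All)
import Data.List.Relation.Unary.All.Properties as Allₚ
open import Data.List.Relation.Unary.AllPairs as AllPairs using (AllPairs; []; _∷_)
import Data.List.Relation.Unary.AllPairs.Properties as AllPairsₚ
open import Data.List.Relation.Unary.Unique.Propositional using (Unique)
import Data.List.Relation.Unary.Unique.Propositional.Properties as Uniqueₚ
open import Data.Product using (_×_; _,_; proj₁; proj₂; ∃; Σ; uncurry)
open import Data.Sum using (inj₁; inj₂)
open import Data.Empty using (⊥; ⊥-elim)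
open import Function using (_∘_; _∘′_)
open import Function.Bundles using (mk⇔)
open import Relation.Nullary using (¬_; Dec; yes; no)
open import Relation.Nullary.Decidable using (map′; _×-dec_; _→-dec_)
open import Relation.Unary using (Decidable)
open import Relation.Binary.Definitions using (tri<; tri≈; tri>)
open import Relation.Binary.PropositionalEquality
  using (_≡_; _≢_; refl; sym; trans; cong; cong₂; subst; subst₂; module ≡-Reasoning)

open +-*-Solver using (solve; _:+_; con; _:=_)

pred<self : ∀ {n} → 0 < n → pred n < n
pred<self {suc n} _ = ≤-refl

-- Indexing from 0, with the junk value 0 beyond the end of the list.
at : List ℕ → ℕ → ℕ
at []       _       = 0
at (x ∷ xs) zero    = x
at (x ∷ xs) (suc i) = at xs i

at-++ˡ : ∀ xs ys {i} → i < length xs → at (xs ++ ys) i ≡ at xs i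
at-++ˡ (x ∷ xs) ys {zero}  _       = refl
at-++ˡ (x ∷ xs) ys {suc i} (s≤s h) = at-++ˡ xs ys h

at-++ʳ : ∀ xs ys i → at (xs ++ ys) (length xs + i) ≡ at ys i
at-++ʳ []       ys i = refl
at-++ʳ (x ∷ xs) ys i = at-++ʳ xs ys i

at-∷ʳ-length : ∀ xs y → at (xs ∷ʳ y) (length xs) ≡ y
at-∷ʳ-length xs y = trans (cong (at (xs ∷ʳ y)) (sym (+-identityʳ (length xs)))) (at-++ʳ xs _ 0)

at-map : ∀ f xs {i} → i < length xs → at (map f xs) i ≡ f (at xs i)
at-map f (x ∷ xs) {zero}  _       = refl
at-map f (x ∷ xs) {suc i} (s≤s h) = at-map f xs h

at-take : ∀ j xs {i} → i < j → at (take j xs) i ≡ at xs i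
at-take (suc j) []       _               = refl
at-take (suc j) (x ∷ xs) {zero}  _       = refl
at-take (suc j) (x ∷ xs) {suc i} (s≤s h) = at-take j xs h

at-drop : ∀ j xs i → at (drop j xs) i ≡ at xs (j + i)
at-drop zero    xs       i = refl
at-drop (suc j) []       i = refl
at-drop (suc j) (x ∷ xs) i = at-drop j xs i

at-applyUpTo : ∀ f k {i} → i < k → at (applyUpTo f k) i ≡ f i
at-applyUpTo f (suc k) {zero}  _       = refl
at-applyUpTo f (suc k) {suc i} (s≤s h) = at-applyUpTo (f ∘′ suc) k h

≡-by-at : ∀ {xs ys} → length xs ≡ length ys → (∀ {i} → i < length xs → at xs i ≡ at ys i) → xs ≡ ys
≡-by-at {[]}     {[]}     _ _ = refl
≡-by-at {x ∷ xs} {y ∷ ys} e h = cong₂ _∷_ (h z<s) (≡-by-at (suc-injective e) (h ∘ s≤s))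

length-take≤ : ∀ {j} (xs : List ℕ) → j ≤ length xs → length (take j xs) ≡ j
length-take≤ {j} xs h = trans (length-take j xs) (m≤n⇒m⊓n≡m h)

last : List ℕ → ℕ
last xs = at xs (pred (length xs))

last-take : ∀ xs {j} → 0 < j → j ≤ length xs → last (take j xs) ≡ at xs (pred j)
last-take xs {suc j} _ j≤xs = trans (cong (λ k → at (take (suc j) xs) (pred k)) (length-take≤ xs j≤xs)) (at-take (suc j) xs ≤-refl)

at-drop-0 : ∀ j xs → at (drop j xs) 0 ≡ at xs j
at-drop-0 j xs = trans (at-drop j xs 0) (cong (at xs) (+-identityʳ j))

last-∷ : ∀ x xs → 0 < length xs → last (x ∷ xs) ≡ last xs
last-∷ x (y ∷ ys) _ = refl

last-drop : ∀ j xs → j < length xs → last (drop j xs) ≡ last xs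
last-drop zero    xs       _          = refl
last-drop (suc j) (x ∷ xs) (s≤s j<xs) = trans (last-drop j xs j<xs) (sym (last-∷ x xs (≤-<-trans z≤n j<xs)))

last-map : ∀ f xs → 0 < length xs → last (map f xs) ≡ f (last xs)
last-map f xs 0<xs = trans (cong (λ n → at (map f xs) (pred n)) (length-map f xs))
                       (at-map f xs (pred<self 0<xs))

shift : ℕ → ℕ → ℕ
shift j x with x <? j
... | yes _ = x
... | no  _ = suc x

unshift : ℕ → ℕ → ℕ
unshift j x with x <? j
... | yes _ = x
... | no  _ = pred x

shift-< : ∀ {j x} → x < j → shift j x ≡ x
shift-< {j} {x} x<j with x <? j
... | yes _   = refl
... | no  x≮j = ⊥-elim (x≮j x<j)

shift-≥ : ∀ {j x} → j ≤ x → shift j x ≡ suc x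
shift-≥ {j} {x} j≤x with x <? j
... | yes x<j = ⊥-elim (<⇒≱ x<j j≤x)
... | no  _   = refl

unshift-< : ∀ {j x} → x < j → unshift j x ≡ x
unshift-< {j} {x} x<j with x <? j
... | yes _   = refl
... | no  x≮j = ⊥-elim (x≮j x<j)

unshift-shift : ∀ j x → unshift j (shift j x) ≡ x
unshift-shift j x with x <? j
... | yes x<j = unshift-< x<j
... | no  x≮j with suc x <? j
...   | yes 1+x<j = ⊥-elim (x≮j (<⇒≤ 1+x<j))
...   | no  _     = refl

shift-unshift : ∀ j x → x ≢ j → shift j (unshift j x) ≡ x
shift-unshift j x x≢j with x <? j
... | yes x<j = shift-< x<j
shift-unshift j zero    x≢j | no x≮j = ⊥-elim (x≢j (sym (n≤0⇒n≡0 (≮⇒≥ x≮j))))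
shift-unshift j (suc x) x≢j | no x≮j =
  shift-≥ (≤-pred (≤∧≢⇒< (≮⇒≥ x≮j) (x≢j ∘ sym)))

shift-mono-< : ∀ j {x y} → x < y → shift j x < shift j y
shift-mono-< j {x} {y} x<y with x <? j | y <? j
... | yes _   | yes _   = x<y
... | yes _   | no  _   = m<n⇒m<1+n x<y
... | no  x≮j | yes y<j = ⊥-elim (x≮j (<-trans x<y y<j))
... | no  _   | no  _   = s<s x<y

shift-cancel-< : ∀ j {x y} → shift j x < shift j y → x < y
shift-cancel-< j {x} {y} h with <-cmp x y
... | tri< x<y _ _ = x<y
... | tri≈ _ refl _ = ⊥-elim (<-irrefl refl h)
... | tri> _ _ y<x = ⊥-elim (<-asym h (shift-mono-< j y<x))

shift-≢ : ∀ j x → shift j x ≢ j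
shift-≢ j x e with x <? j
... | yes x<j = <-irrefl e x<j
... | no  x≮j = x≮j (subst (x <_) e ≤-refl)

shift≤suc : ∀ j x → shift j x ≤ suc x
shift≤suc j x with x <? j
... | yes _ = n≤1+n x
... | no  _ = ≤-refl

≤shift : ∀ j x → x ≤ shift j x
≤shift j x with x <? j
... | yes _ = ≤-refl
... | no  _ = n≤1+n x

<shift⇒≤ : ∀ {j x} → j < shift j x → j ≤ x
<shift⇒≤ {j} {x} j<shift with x <? j
... | yes x<j = ⊥-elim (<-asym j<shift x<j)
... | no  x≮j = ≮⇒≥ x≮j

unshift-bounded : ∀ {j x n} → j < suc n → x < suc n → x ≢ j → unshift j x < n
unshift-bounded {j} {x} j<1+n x<1+n x≢j with x <? j
... | yes x<j = <-≤-trans x<j (s≤s⁻¹ j<1+n)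
unshift-bounded {j} {zero}  j<1+n x<1+n x≢j | no x≮j = ⊥-elim (x≢j (sym (n≤0⇒n≡0 (≮⇒≥ x≮j))))
unshift-bounded {j} {suc x} j<1+n x<1+n x≢j | no x≮j = s≤s⁻¹ x<1+n

unshift-≥ : ∀ {j x} → j ≤ x → unshift j x ≡ pred x
unshift-≥ {j} {x} j≤x with x <? j
... | yes x<j = ⊥-elim (<⇒≱ x<j j≤x)
... | no  _   = refl

shift-<-suc : ∀ {j i x} → j ≤ x → shift j i < suc x → i < x
shift-<-suc {j} {i} j≤x shift<1+x with i <? j
... | yes i<j = <-≤-trans i<j j≤x
... | no  _   = s≤s⁻¹ shift<1+x

𝟙 : ∀ {A : Set} → Dec A → ℕ
𝟙 (yes _) = 1
𝟙 (no  _) = 0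

𝟙-yes : ∀ {A : Set} (a? : Dec A) → A → 𝟙 a? ≡ 1
𝟙-yes (yes _) _ = refl
𝟙-yes (no ¬a) a = ⊥-elim (¬a a)

𝟙-no : ∀ {A : Set} (a? : Dec A) → ¬ A → 𝟙 a? ≡ 0
𝟙-no (yes a) ¬a = ⊥-elim (¬a a)
𝟙-no (no _)  _  = refl

𝟙-cong : ∀ {A B : Set} (a? : Dec A) (b? : Dec B) → (A → B) → (B → A) → 𝟙 a? ≡ 𝟙 b?
𝟙-cong (yes a) b? f g = sym (𝟙-yes b? (f a))
𝟙-cong (no ¬a) b? f g = sym (𝟙-no b? (¬a ∘ g))

∑ : ∀ {A : Set} → (A → ℕ) → List A → ℕ
∑ f []       = 0
∑ f (x ∷ xs) = f x + ∑ f xs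

∑-++ : ∀ {A : Set} (f : A → ℕ) xs ys → ∑ f (xs ++ ys) ≡ ∑ f xs + ∑ f ys
∑-++ f []       ys = refl
∑-++ f (x ∷ xs) ys = trans (cong (f x +_) (∑-++ f xs ys)) (sym (+-assoc (f x) _ _))

∑-map : ∀ {A B : Set} (f : B → ℕ) (g : A → B) xs → ∑ f (map g xs) ≡ ∑ (f ∘ g) xs
∑-map f g []       = refl
∑-map f g (x ∷ xs) = cong (f (g x) +_) (∑-map f g xs)

∑-concatMap : ∀ {A B : Set} (f : B → ℕ) (g : A → List B) xs → ∑ f (concatMap g xs) ≡ ∑ (∑ f ∘ g) xs
∑-concatMap f g []       = refl
∑-concatMap f g (x ∷ xs) = trans (∑-++ f (g x) (concatMap g xs)) (cong (∑ f (g x) +_) (∑-concatMap f g xs))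

∑-cong : ∀ {A : Set} {f g : A → ℕ} xs → (∀ {x} → x ∈ xs → f x ≡ g x) → ∑ f xs ≡ ∑ g xs
∑-cong []       _   = refl
∑-cong (x ∷ xs) f≡g = cong₂ _+_ (f≡g (here refl)) (∑-cong xs (f≡g ∘ there))

∑-zero : ∀ {A : Set} {f : A → ℕ} xs → (∀ {x} → x ∈ xs → f x ≡ 0) → ∑ f xs ≡ 0
∑-zero []       _    = refl
∑-zero (x ∷ xs) f≡0 = cong₂ _+_ (f≡0 (here refl)) (∑-zero xs (f≡0 ∘ there))

∑-+ : ∀ {A : Set} (f g : A → ℕ) xs → ∑ (λ x → f x + g x) xs ≡ ∑ f xs + ∑ g xs
∑-+ f g []       = refl
∑-+ f g (x ∷ xs) = trans (cong (f x + g x +_) (∑-+ f g xs)) (+-+-comm-middle (f x) (g x) (∑ f xs) (∑ g xs))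
  where
    +-+-comm-middle : ∀ a b c d → a + b + (c + d) ≡ a + c + (b + d)
    +-+-comm-middle = solve 4 (λ a b c d → a :+ b :+ (c :+ d) := a :+ c :+ (b :+ d)) refl

∑-*ˡ : ∀ {A : Set} c (f : A → ℕ) xs → ∑ (λ x → c * f x) xs ≡ c * ∑ f xs
∑-*ˡ c f []       = sym (*-zeroʳ c)
∑-*ˡ c f (x ∷ xs) = trans (cong (c * f x +_) (∑-*ˡ c f xs)) (sym (*-distribˡ-+ c (f x) (∑ f xs)))

module _ {A : Set} {P : A → Set} (P? : Decidable P) where

  length-filter≡∑ : ∀ xs → length (filter P? xs) ≡ ∑ (𝟙 ∘ P?) xs
  length-filter≡∑ []       = refl
  length-filter≡∑ (x ∷ xs) with P? x
  ... | yes _ = cong suc (length-filter≡∑ xs)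
  ... | no  _ = length-filter≡∑ xs

  ∑-filter : ∀ (f : A → ℕ) xs → ∑ f (filter P? xs) ≡ ∑ (λ x → 𝟙 (P? x) * f x) xs
  ∑-filter f []       = refl
  ∑-filter f (x ∷ xs) with P? x
  ... | yes _ = cong₂ _+_ (sym (+-identityʳ (f x))) (∑-filter f xs)
  ... | no  _ = ∑-filter f xs

𝟙-×-dec : ∀ {A B : Set} (a? : Dec A) (b? : Dec B) → 𝟙 (a? ×-dec b?) ≡ 𝟙 a? * 𝟙 b?
𝟙-×-dec (yes _) (yes _) = refl
𝟙-×-dec (yes _) (no _)  = refl
𝟙-×-dec (no _)  _       = refl

∸-peel : ∀ a u → a ∸ u ≡ 𝟙 (u <? a) + (a ∸ suc u)
∸-peel zero    u       = 0∸n≡0 u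
∸-peel (suc a) zero    = refl
∸-peel (suc a) (suc u) = trans (∸-peel a u) (cong (_+ (a ∸ suc u)) (𝟙-cong (u <? a) (suc u <? suc a) s≤s s≤s⁻¹))

∑-long-suffixes : ∀ u xs → AllPairs _<_ xs → ∑ (λ x → 𝟙 (u <? length (filter (x ≤?_) xs))) xs ≡ length xs ∸ u
∑-long-suffixes u []       []           = sym (0∸n≡0 u)
∑-long-suffixes u (x ∷ xs) (x<xs ∷ inc) = begin
  𝟙 (u <? length (filter (x ≤?_) (x ∷ xs))) + ∑ (λ y → 𝟙 (u <? length (filter (y ≤?_) (x ∷ xs)))) xs
    ≡⟨ cong₂ _+_ (cong (λ l → 𝟙 (u <? length l)) all-above-x)
                 (∑-cong xs (λ y∈ → cong (λ l → 𝟙 (u <? length l)) (filter-reject (_ ≤?_) (<⇒≱ (All.lookup x<xs y∈))))) ⟩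
  𝟙 (u <? suc (length xs)) + ∑ (λ y → 𝟙 (u <? length (filter (y ≤?_) xs))) xs
    ≡⟨ cong (𝟙 (u <? suc (length xs)) +_) (∑-long-suffixes u xs inc) ⟩
  𝟙 (u <? suc (length xs)) + (length xs ∸ u)
    ≡⟨ ∸-peel (suc (length xs)) u ⟨
  suc (length xs) ∸ u
    ∎
  where
    open ≡-Reasoning
    all-above-x : filter (x ≤?_) (x ∷ xs) ≡ x ∷ xs
    all-above-x = filter-all (x ≤?_) (≤-refl All.∷ All.map <⇒≤ x<xs)

unique⇒length-≡ : ∀ {A : Set} {xs ys : List A} → Unique xs → Unique ys →
                  (∀ {x} → x ∈ xs → x ∈ ys) → (∀ {x} → x ∈ ys → x ∈ xs) → length xs ≡ length ys
unique⇒length-≡ xs! ys! xs⊆ys ys⊆xs = ↭-length (∼bag⇒↭ (unique∧set⇒bag xs! ys! (mk⇔ xs⊆ys ys⊆xs)))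

injective-into-interval : ∀ {k lo hi} (f : ℕ → ℕ) → (∀ {x} → x < k → lo ≤ f x × f x < hi) →
                          (∀ {x y} → x < k → y < k → f x ≡ f y → x ≡ y) → k ≤ hi ∸ lo
injective-into-interval {k} {lo} {hi} f into f-injective = injective⇒≤ {f = g} g-injective
  where
    g : Fin k → Fin (hi ∸ lo)
    g i = fromℕ< (∸-monoˡ-< (proj₂ (into (toℕ<n i))) (proj₁ (into (toℕ<n i))))

    g-injective : ∀ {i i′} → g i ≡ g i′ → i ≡ i′
    g-injective {i} {i′} e = toℕ-injective (f-injective (toℕ<n i) (toℕ<n i′)
      (∸-cancelʳ-≡ (proj₁ (into (toℕ<n i))) (proj₁ (into (toℕ<n i′)))
        (trans (sym (toℕ-fromℕ< _)) (trans (cong toℕ e) (toℕ-fromℕ< _)))))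

≤⌊/2⌋⇒+≤ : ∀ {j m} → j ≤ ⌊ m /2⌋ → j + j ≤ m
≤⌊/2⌋⇒+≤ {j} {m} j≤ = ≤-trans (+-mono-≤ j≤ (≤-trans j≤ (⌊n/2⌋≤⌈n/2⌉ m))) (≤-reflexive (⌊n/2⌋+⌈n/2⌉≡n m))

+≤⇒≤⌊/2⌋ : ∀ {j m} → j + j ≤ m → j ≤ ⌊ m /2⌋
+≤⇒≤⌊/2⌋ {j} j+j≤m = subst (_≤ _) (sym (n≡⌊n+n/2⌋ j)) (⌊n/2⌋-mono j+j≤m)

⌊n/2⌋≡n/2 : ∀ n → ⌊ n /2⌋ ≡ n / 2
⌊n/2⌋≡n/2 zero          = refl
⌊n/2⌋≡n/2 (suc zero)    = refl
⌊n/2⌋≡n/2 (suc (suc n)) = trans (cong suc (⌊n/2⌋≡n/2 n)) (sym (m/n≡1+[m∸n]/n {suc (suc n)} {2} (s≤s (s≤s z≤n))))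

-- Involutions in one-line notation

record IsInvolutionℕ (n : ℕ) (ℓ : List ℕ) : Set where
  field
    length≡    : length ℓ ≡ n
    bounded    : ∀ {i} → i < n → at ℓ i < n
    involutive : ∀ {i} → i < n → at ℓ (at ℓ i) ≡ i

  injective : ∀ {i i′} → i < n → i′ < n → at ℓ i ≡ at ℓ i′ → i ≡ i′
  injective {i} {i′} i<n i′<n e = trans (sym (involutive i<n)) (trans (cong (at ℓ) e) (involutive i′<n))

Contains132ℕ : ℕ → List ℕ → Set
Contains132ℕ n ℓ = ∃ λ a → ∃ λ b → ∃ λ c →
  a < b × b < c × c < n × at ℓ a < at ℓ c × at ℓ c < at ℓ b

Avoids132ℕ : ℕ → List ℕ → Set
Avoids132ℕ n ℓ = ¬ Contains132ℕ n ℓ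

appendFixed : List ℕ → List ℕ
appendFixed σ = σ ∷ʳ length σ

-- For an involution σ of {0, …, m-1}, `insertCycle σ j` adjoins the 2-cycle (j, m+1): the entries
-- of σ are shifted past j, position j receives m+1 and the new last position m+1 receives j.
insertCycle : List ℕ → ℕ → List ℕ
insertCycle σ j = (map (shift j) (take j σ) ++ suc (length σ) ∷ map (shift j) (drop j σ)) ∷ʳ j

module AppendFixed {m} (σ : List ℕ) (len : length σ ≡ m) where

  length-appendFixed : length (appendFixed σ) ≡ suc m
  length-appendFixed = trans (length-++ σ) (trans (+-comm (length σ) 1) (cong suc len))

  at-appendFixed : ∀ {i} → i < m → at (appendFixed σ) i ≡ at σ i
  at-appendFixed i<m = at-++ˡ σ _ (subst (_ <_) (sym len) i<m)

  at-appendFixed-last : at (appendFixed σ) m ≡ m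
  at-appendFixed-last = subst (λ k → at (appendFixed σ) k ≡ k) len (at-∷ʳ-length σ (length σ))

module InsertCycle {m} (σ : List ℕ) (len : length σ ≡ m) {j} (j≤m : j ≤ m) where

  private
    front back body : List ℕ
    front = map (shift j) (take j σ)
    back  = map (shift j) (drop j σ)
    body  = front ++ suc (length σ) ∷ back

    length-front : length front ≡ j
    length-front = trans (length-map _ (take j σ)) (length-take≤ σ (subst (j ≤_) (sym len) j≤m))

    length-drop≡ : length (drop j σ) ≡ m ∸ j
    length-drop≡ = trans (length-drop j σ) (cong (_∸ j) len)

    length-body : length body ≡ suc m
    length-body = begin
      length body                       ≡⟨ length-++ front ⟩
      length front + suc (length back)  ≡⟨ cong₂ (λ a b → a + suc b) length-front (trans (length-map _ (drop j σ)) length-drop≡) ⟩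
      j + suc (m ∸ j)                   ≡⟨ +-suc j (m ∸ j) ⟩
      suc (j + (m ∸ j))                 ≡⟨ cong suc (m+[n∸m]≡n j≤m) ⟩
      suc m                             ∎
      where open ≡-Reasoning

    at-body : ∀ {i} → i < suc m → at (insertCycle σ j) i ≡ at body i
    at-body i<1+m = at-++ˡ body _ (subst (_ <_) (sym length-body) i<1+m)

    at-body-from-j : ∀ k → at body (j + k) ≡ at (suc (length σ) ∷ back) k
    at-body-from-j k = subst (λ l → at body (l + k) ≡ at (suc (length σ) ∷ back) k) length-front (at-++ʳ front _ k)

  length-insertCycle : length (insertCycle σ j) ≡ suc (suc m)
  length-insertCycle = trans (length-++ body) (trans (+-comm (length body) 1) (cong suc length-body))

  at-front : ∀ {i} → i < j → at (insertCycle σ j) i ≡ shift j (at σ i)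
  at-front {i} i<j = begin
    at (insertCycle σ j) i  ≡⟨ at-body (m<n⇒m<1+n (<-≤-trans i<j j≤m)) ⟩
    at body i               ≡⟨ at-++ˡ front _ (subst (i <_) (sym length-front) i<j) ⟩
    at front i              ≡⟨ at-map (shift j) (take j σ) (subst (i <_) (sym (length-take≤ σ (subst (j ≤_) (sym len) j≤m))) i<j) ⟩
    shift j (at (take j σ) i) ≡⟨ cong (shift j) (at-take j σ i<j) ⟩
    shift j (at σ i)        ∎
    where open ≡-Reasoning

  at-j : at (insertCycle σ j) j ≡ suc m
  at-j = begin
    at (insertCycle σ j) j      ≡⟨ at-body (s≤s j≤m) ⟩
    at body j                   ≡⟨ cong (at body) (sym (+-identityʳ j)) ⟩
    at body (j + 0)             ≡⟨ at-body-from-j 0 ⟩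
    suc (length σ)              ≡⟨ cong suc len ⟩
    suc m                       ∎
    where open ≡-Reasoning

  at-back : ∀ {i} → j ≤ i → i < m → at (insertCycle σ j) (suc i) ≡ shift j (at σ i)
  at-back {i} j≤i i<m = begin
    at (insertCycle σ j) (suc i)      ≡⟨ at-body (s<s i<m) ⟩
    at body (suc i)                   ≡⟨ cong (at body) (sym (trans (+-suc j (i ∸ j)) (cong suc (m+[n∸m]≡n j≤i)))) ⟩
    at body (j + suc (i ∸ j))         ≡⟨ at-body-from-j (suc (i ∸ j)) ⟩
    at back (i ∸ j)                   ≡⟨ at-map (shift j) (drop j σ) (subst (i ∸ j <_) (sym length-drop≡) (∸-monoˡ-< i<m j≤i)) ⟩
    shift j (at (drop j σ) (i ∸ j))   ≡⟨ cong (shift j) (trans (at-drop j σ (i ∸ j)) (cong (at σ) (m+[n∸m]≡n j≤i))) ⟩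
    shift j (at σ i)                  ∎
    where open ≡-Reasoning

  at-last : at (insertCycle σ j) (suc m) ≡ j
  at-last = subst (λ k → at (insertCycle σ j) k ≡ j) length-body (at-∷ʳ-length body j)

  at-shift : ∀ {i} → i < m → at (insertCycle σ j) (shift j i) ≡ shift j (at σ i)
  at-shift {i} i<m with i <? j
  ... | yes i<j = at-front i<j
  ... | no  i≮j = at-back (≮⇒≥ i≮j) i<m

  data Position (p : ℕ) : Set where
    cycle-start : p ≡ j → Position p
    cycle-end   : p ≡ suc m → Position p
    shifted     : ∀ {i} → i < m → p ≡ shift j i → Position p

  position : ∀ {p} → p < suc (suc m) → Position p
  position {p} p<2+m with p <? j | p ≟ j
  ... | yes p<j | _      = shifted (<-≤-trans p<j j≤m) (sym (shift-< p<j))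
  ... | no  _   | yes p≡j = cycle-start p≡j
  position {zero}  _          | no p≮j | no p≢j = ⊥-elim (p≢j (sym (n≤0⇒n≡0 (≮⇒≥ p≮j))))
  position {suc i} (s≤s i<1+m) | no p≮j | no p≢j with m≤n⇒m<n∨m≡n (s≤s⁻¹ i<1+m)
  ... | inj₁ i<m = shifted i<m (sym (shift-≥ (s≤s⁻¹ (≤∧≢⇒< (≮⇒≥ p≮j) (p≢j ∘ sym)))))
  ... | inj₂ i≡m = cycle-end (cong suc i≡m)

-- The j at which the 2-cycle (j, m+1) can be adjoined to σ without creating a 132.
record SwapsEnds (m : ℕ) (σ : List ℕ) (j : ℕ) : Set where
  constructor mkSwapsEnds
  field
    front↦back : ∀ {i} → i < j → m ∸ j ≤ at σ i
    back↦front : ∀ {i} → i < m → m ∸ j ≤ i → at σ i < j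

module SwapsEndsInvolution {m σ j} (I : IsInvolutionℕ m σ) (S : SwapsEnds m σ j) where

  open IsInvolutionℕ I
  open SwapsEnds S

  small-value⇒back : ∀ {i} → i < m → at σ i < j → m ∸ j ≤ i
  small-value⇒back i<m σi<j = subst (m ∸ j ≤_) (involutive i<m) (front↦back σi<j)

  non-front⇒small-value : ∀ {i} → i < m → j ≤ i → at σ i < m ∸ j
  non-front⇒small-value {i} i<m j≤i with at σ i <? m ∸ j
  ... | yes σi<m∸j = σi<m∸j
  ... | no  σi≮m∸j = ⊥-elim (<⇒≱ (subst (_< j) (involutive i<m) (back↦front (bounded i<m) (≮⇒≥ σi≮m∸j))) j≤i)

appendFixed-involution : ∀ {m σ} → IsInvolutionℕ m σ → IsInvolutionℕ (suc m) (appendFixed σ)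
appendFixed-involution {m} {σ} I = record
  { length≡ = length-appendFixed ; bounded = bounded′ ; involutive = involutive′ }
  where
    open IsInvolutionℕ I
    open AppendFixed σ length≡

    bounded′ : ∀ {i} → i < suc m → at (appendFixed σ) i < suc m
    bounded′ i<1+m with m<1+n⇒m<n∨m≡n i<1+m
    ... | inj₁ i<m  = subst (_< suc m) (sym (at-appendFixed i<m)) (m<n⇒m<1+n (bounded i<m))
    ... | inj₂ refl = subst (_< suc m) (sym at-appendFixed-last) ≤-refl

    involutive′ : ∀ {i} → i < suc m → at (appendFixed σ) (at (appendFixed σ) i) ≡ i
    involutive′ {i} i<1+m with m<1+n⇒m<n∨m≡n i<1+m
    ... | inj₁ i<m  = begin
      at (appendFixed σ) (at (appendFixed σ) i)  ≡⟨ cong (at (appendFixed σ)) (at-appendFixed i<m) ⟩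
      at (appendFixed σ) (at σ i)                ≡⟨ at-appendFixed (bounded i<m) ⟩
      at σ (at σ i)                              ≡⟨ involutive i<m ⟩
      i                                          ∎
      where open ≡-Reasoning
    ... | inj₂ refl = trans (cong (at (appendFixed σ)) at-appendFixed-last) at-appendFixed-last

appendFixed-avoids : ∀ {m σ} → IsInvolutionℕ m σ → Avoids132ℕ m σ → Avoids132ℕ (suc m) (appendFixed σ)
appendFixed-avoids {m} {σ} I av (a , b , c , a<b , b<c , c<1+m , πa<πc , πc<πb)
  with m<1+n⇒m<n∨m≡n c<1+m
... | inj₁ c<m  = av (a , b , c , a<b , b<c , c<m ,
                      subst₂ _<_ (at-appendFixed a<m) (at-appendFixed c<m) πa<πc ,
                      subst₂ _<_ (at-appendFixed c<m) (at-appendFixed b<m) πc<πb)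
  where
    open AppendFixed σ (IsInvolutionℕ.length≡ I)
    b<m = <-trans b<c c<m
    a<m = <-trans a<b b<m
... | inj₂ refl = <-asym πc<πb (subst₂ _<_ (sym (at-appendFixed b<c)) (sym at-appendFixed-last)
                                           (IsInvolutionℕ.bounded I b<c))
  where open AppendFixed σ (IsInvolutionℕ.length≡ I)

insertCycle-involution : ∀ {m σ j} → IsInvolutionℕ m σ → j ≤ m → IsInvolutionℕ (suc (suc m)) (insertCycle σ j)
insertCycle-involution {m} {σ} {j} I j≤m = record
  { length≡ = length-insertCycle ; bounded = bounded′ ; involutive = involutive′ }
  where
    open IsInvolutionℕ I
    open InsertCycle σ length≡ j≤m
    π = insertCycle σ j

    bounded′ : ∀ {p} → p < suc (suc m) → at π p < suc (suc m)
    bounded′ p<2+m with position p<2+m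
    ... | cycle-start refl = subst (_< suc (suc m)) (sym at-j) ≤-refl
    ... | cycle-end   refl = subst (_< suc (suc m)) (sym at-last) (s≤s (m≤n⇒m≤1+n j≤m))
    ... | shifted i<m refl = subst (_< suc (suc m)) (sym (at-shift i<m))
                               (s≤s (m≤n⇒m≤1+n (≤-trans (shift≤suc j _) (bounded i<m))))

    involutive′ : ∀ {p} → p < suc (suc m) → at π (at π p) ≡ p
    involutive′ p<2+m with position p<2+m
    ... | cycle-start refl = trans (cong (at π) at-j) at-last
    ... | cycle-end   refl = trans (cong (at π) at-last) at-j
    ... | shifted {i} i<m refl = begin
      at π (at π (shift j i))        ≡⟨ cong (at π) (at-shift i<m) ⟩
      at π (shift j (at σ i))        ≡⟨ at-shift (bounded i<m) ⟩
      shift j (at σ (at σ i))        ≡⟨ cong (shift j) (involutive i<m) ⟩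
      shift j i                      ∎
      where open ≡-Reasoning

module InsertCycleAvoids {m σ j} (I : IsInvolutionℕ m σ) (av : Avoids132ℕ m σ)
                         (j+j≤m : j + j ≤ m) (S : SwapsEnds m σ j) where

  open IsInvolutionℕ I
  open SwapsEnds S
  open SwapsEndsInvolution I S
  private
    j≤m : j ≤ m
    j≤m = ≤-trans (m≤m+n j j) j+j≤m

  open InsertCycle σ length≡ j≤m

  private
    π = insertCycle σ j

    j≤m∸j : j ≤ m ∸ j
    j≤m∸j = m+n≤o⇒m≤o∸n j j+j≤m

    shift≤m : ∀ {i} → i < m → shift j i ≤ m
    shift≤m i<m = ≤-trans (shift≤suc j _) i<m

    π-bounded : ∀ {p} → p < suc (suc m) → at π p < suc (suc m)
    π-bounded = IsInvolutionℕ.bounded (insertCycle-involution I j≤m)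

  no132-ending-at-start : ∀ {b} → b < j → at π j < at π b → ⊥
  no132-ending-at-start {b} b<j πj<πb =
    <⇒≱ (subst (_< at π b) at-j πj<πb) (s≤s⁻¹ (π-bounded (<-trans b<j (s≤s (m≤n⇒m≤1+n j≤m)))))

  no-large-after-back : ∀ {ia b} → ia < m → m ∸ j ≤ ia → shift j ia < b → b < suc m → j < at π b → ⊥
  no-large-after-back {ia} ia<m ia-back a<b b<1+m j<πb with position (<-trans b<1+m (n<1+n _))
  ... | cycle-start refl = <⇒≱ a<b (≤-trans (≤-trans j≤m∸j ia-back) (≤shift j ia))
  ... | cycle-end   refl = <-irrefl refl b<1+m
  ... | shifted {ib} ib<m refl =
    <⇒≱ j<πb (<⇒≤ (subst (_< j) (sym (trans (at-shift ib<m) (shift-< σib<j))) σib<j))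
    where
      σib<j : at σ ib < j
      σib<j = back↦front ib<m (≤-trans ia-back (<⇒≤ (shift-cancel-< j a<b)))

  no132-ending-at-end : ∀ {a b} → a < b → b < suc m → at π a < j → j < at π b → ⊥
  no132-ending-at-end {a} {b} a<b b<1+m πa<j j<πb with position (<-trans (<-trans a<b b<1+m) (n<1+n _))
  ... | cycle-start refl = <⇒≱ (subst (_< j) at-j πa<j) (m≤n⇒m≤1+n j≤m)
  ... | cycle-end   refl = <⇒≱ (<-trans a<b b<1+m) ≤-refl
  ... | shifted ia<m refl = no-large-after-back ia<m
        (small-value⇒back ia<m (≤-<-trans (≤shift j _) (subst (_< j) (at-shift ia<m) πa<j))) a<b b<1+m j<πb

  no132-ending-shifted : ∀ {a b ic} → a < b → b < shift j ic → ic < m →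
                         at π a < at π (shift j ic) → at π (shift j ic) < at π b → ⊥
  no132-ending-shifted {a} {b} {ic} a<b b<c ic<m πa<πc πc<πb
    with position (<-trans b<c (s≤s (m≤n⇒m≤1+n (shift≤m ic<m))))
  ... | cycle-end refl = <⇒≱ b<c (m≤n⇒m≤1+n (shift≤m ic<m))
  ... | cycle-start refl with position (<-trans a<b (s≤s (m≤n⇒m≤1+n j≤m)))
  ...   | cycle-start refl = <-irrefl refl a<b
  ...   | cycle-end   refl = <⇒≱ a<b (m≤n⇒m≤1+n j≤m)
  ...   | shifted {ia} ia<m refl = <⇒≱ πa<πc (<⇒≤ (subst₂ _<_ (sym (at-shift ic<m)) (sym (at-shift ia<m))
                                                  (shift-mono-< j (<-≤-trans σic<m∸j (front↦back ia<j)))))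
    where
      ia<j : ia < j
      ia<j = ≤-<-trans (≤shift j ia) a<b
      σic<m∸j : at σ ic < m ∸ j
      σic<m∸j = non-front⇒small-value ic<m (<shift⇒≤ b<c)
  no132-ending-shifted {a} {b} {ic} a<b b<c ic<m πa<πc πc<πb | shifted {ib} ib<m refl
    with position (<-trans a<b (s≤s (m≤n⇒m≤1+n (shift≤m ib<m))))
  ... | cycle-start refl = <⇒≱ (subst (_< at π (shift j ic)) at-j πa<πc)
                                (s≤s⁻¹ (π-bounded (s≤s (m≤n⇒m≤1+n (shift≤m ic<m)))))
  ... | cycle-end   refl = <⇒≱ a<b (m≤n⇒m≤1+n (shift≤m ib<m))
  ... | shifted {ia} ia<m refl = av (ia , ib , ic , shift-cancel-< j a<b , shift-cancel-< j b<c , ic<m ,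
        shift-cancel-< j (subst₂ _<_ (at-shift ia<m) (at-shift ic<m) πa<πc) ,
        shift-cancel-< j (subst₂ _<_ (at-shift ic<m) (at-shift ib<m) πc<πb))

  insertCycle-avoids : Avoids132ℕ (suc (suc m)) π
  insertCycle-avoids (a , b , c , a<b , b<c , c<2+m , πa<πc , πc<πb) with position c<2+m
  ... | cycle-start refl = no132-ending-at-start b<c πc<πb
  ... | cycle-end   refl = no132-ending-at-end a<b b<c (subst (at π a <_) at-last πa<πc) (subst (_< at π b) at-last πc<πb)
  ... | shifted ic<m refl = no132-ending-shifted a<b b<c ic<m πa<πc πc<πb

-- Decomposing a 132-avoiding involution

module RemoveFixed {n π} (I : IsInvolutionℕ (suc n) π) (fixed : at π n ≡ n) where

  open IsInvolutionℕ I

  σ : List ℕ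
  σ = take n π

  private
    length-σ : length σ ≡ n
    length-σ = length-take≤ π (subst (n ≤_) (sym length≡) (n≤1+n n))

    at-σ : ∀ {i} → i < n → at σ i ≡ at π i
    at-σ = at-take n π

    π-bounded : ∀ {i} → i < n → at π i < n
    π-bounded {i} i<n with m<1+n⇒m<n∨m≡n (bounded (m<n⇒m<1+n i<n))
    ... | inj₁ πi<n = πi<n
    ... | inj₂ πi≡n = ⊥-elim (<-irrefl (injective (m<n⇒m<1+n i<n) ≤-refl (trans πi≡n (sym fixed))) i<n)

  open AppendFixed σ length-σ

  reassemble : appendFixed σ ≡ π
  reassemble = ≡-by-at (trans length-appendFixed (sym length≡)) pointwise
    where
      pointwise : ∀ {i} → i < length (appendFixed σ) → at (appendFixed σ) i ≡ at π i
      pointwise i< with m<1+n⇒m<n∨m≡n (subst (_ <_) length-appendFixed i<)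
      ... | inj₁ i<n  = trans (at-appendFixed i<n) (at-σ i<n)
      ... | inj₂ refl = trans at-appendFixed-last (sym fixed)

  involution : IsInvolutionℕ n σ
  involution = record
    { length≡    = length-σ
    ; bounded    = λ i<n → subst (_< n) (sym (at-σ i<n)) (π-bounded i<n)
    ; involutive = λ i<n → trans (cong (at σ) (at-σ i<n))
                             (trans (at-σ (π-bounded i<n)) (involutive (m<n⇒m<1+n i<n)))
    }

  avoids : Avoids132ℕ (suc n) π → Avoids132ℕ n σ
  avoids av (a , b , c , a<b , b<c , c<n , σa<σc , σc<σb) =
    av (a , b , c , a<b , b<c , m<n⇒m<1+n c<n ,
        subst₂ _<_ (at-σ (<-trans a<b b<n)) (at-σ c<n) σa<σc ,
        subst₂ _<_ (at-σ c<n) (at-σ b<n) σc<σb)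
    where b<n = <-trans b<c c<n

module RemoveCycle {m π} (I : IsInvolutionℕ (suc (suc m)) π) (av : Avoids132ℕ (suc (suc m)) π)
                   (moved : at π (suc m) ≢ suc m) where

  open IsInvolutionℕ I

  j : ℕ
  j = at π (suc m)

  private
    last<2+m : suc m < suc (suc m)
    last<2+m = ≤-refl

    j≤m : j ≤ m
    j≤m with m<1+n⇒m<n∨m≡n (bounded last<2+m)
    ... | inj₁ j<1+m = s≤s⁻¹ j<1+m
    ... | inj₂ j≡1+m = ⊥-elim (moved j≡1+m)

    j<2+m : j < suc (suc m)
    j<2+m = s≤s (m≤n⇒m≤1+n j≤m)

    πj≡1+m : at π j ≡ suc m
    πj≡1+m = involutive last<2+m

    value≢top : ∀ {p} → p < suc (suc m) → p ≢ j → at π p ≢ suc m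
    value≢top p< p≢j e = p≢j (injective p< j<2+m (trans e (sym πj≡1+m)))

    value≢j : ∀ {p} → p < suc (suc m) → p ≢ suc m → at π p ≢ j
    value≢j p< p≢1+m e = p≢1+m (injective p< last<2+m e)

    value<top : ∀ {p} → p < suc (suc m) → p ≢ j → at π p < suc m
    value<top p< p≢j with m<1+n⇒m<n∨m≡n (bounded p<)
    ... | inj₁ πp<1+m = πp<1+m
    ... | inj₂ πp≡1+m = ⊥-elim (value≢top p< p≢j πp≡1+m)

    shift<2+m : ∀ {i} → i < m → shift j i < suc (suc m)
    shift<2+m i<m = s≤s (m≤n⇒m≤1+n (≤-trans (shift≤suc j _) i<m))

    shift≢last : ∀ {i} → i < m → shift j i ≢ suc m
    shift≢last i<m e = <-irrefl e (≤-<-trans (shift≤suc j _) (s≤s i<m))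

  σ : List ℕ
  σ = applyUpTo (λ i → unshift j (at π (shift j i))) m

  private
    length-σ : length σ ≡ m
    length-σ = length-applyUpTo _ m

    at-σ : ∀ {i} → i < m → at σ i ≡ unshift j (at π (shift j i))
    at-σ = at-applyUpTo _ m

    shift-at-σ : ∀ {i} → i < m → shift j (at σ i) ≡ at π (shift j i)
    shift-at-σ i<m = trans (cong (shift j) (at-σ i<m))
      (shift-unshift j _ (value≢j (shift<2+m i<m) (shift≢last i<m)))

    σ-bounded : ∀ {i} → i < m → at σ i < m
    σ-bounded i<m = subst (_< m) (sym (at-σ i<m))
      (unshift-bounded (s≤s j≤m) (value<top (shift<2+m i<m) (shift-≢ j _)) (value≢j (shift<2+m i<m) (shift≢last i<m)))

  involution : IsInvolutionℕ m σ
  involution = record { length≡ = length-σ ; bounded = σ-bounded ; involutive = σ-involutive }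
    where
      σ-involutive : ∀ {i} → i < m → at σ (at σ i) ≡ i
      σ-involutive {i} i<m = begin
        at σ (at σ i)                              ≡⟨ at-σ (σ-bounded i<m) ⟩
        unshift j (at π (shift j (at σ i)))        ≡⟨ cong (unshift j ∘ at π) (shift-at-σ i<m) ⟩
        unshift j (at π (at π (shift j i)))        ≡⟨ cong (unshift j) (involutive (shift<2+m i<m)) ⟩
        unshift j (shift j i)                      ≡⟨ unshift-shift j i ⟩
        i                                          ∎
        where open ≡-Reasoning

  reassemble : insertCycle σ j ≡ π
  reassemble = ≡-by-at (trans length-insertCycle (sym length≡)) pointwise
    where
      open InsertCycle σ length-σ j≤m
      pointwise : ∀ {p} → p < length (insertCycle σ j) → at (insertCycle σ j) p ≡ at π p
      pointwise p< with position (subst (_ <_) length-insertCycle p<)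
      ... | cycle-start refl = trans at-j (sym (involutive last<2+m))
      ... | cycle-end   refl = at-last
      ... | shifted i<m refl = trans (at-shift i<m) (shift-at-σ i<m)

  avoids : Avoids132ℕ m σ
  avoids (a , b , c , a<b , b<c , c<m , σa<σc , σc<σb) =
    av (shift j a , shift j b , shift j c , shift-mono-< j a<b , shift-mono-< j b<c , shift<2+m c<m ,
        subst₂ _<_ (shift-at-σ a<m) (shift-at-σ c<m) (shift-mono-< j σa<σc) ,
        subst₂ _<_ (shift-at-σ c<m) (shift-at-σ b<m) (shift-mono-< j σc<σb))
    where
      b<m = <-trans b<c c<m
      a<m = <-trans a<b b<m

  -- π j = m+1 is the largest value, so a < j < c with π a < π c would be a 132.
  front-above-back : ∀ {a c} → a < j → j < c → c < suc (suc m) → at π c < at π a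
  front-above-back {a} {c} a<j j<c c< with <-cmp (at π c) (at π a)
  ... | tri< πc<πa _ _ = πc<πa
  ... | tri≈ _ πc≡πa _ = ⊥-elim (<-irrefl (injective (<-trans a<j j<2+m) c< (sym πc≡πa)) (<-trans a<j j<c))
  ... | tri> _ _ πa<πc = ⊥-elim (av (a , j , c , a<j , j<c , c< , πa<πc ,
          subst (at π c <_) (sym πj≡1+m) (value<top c< (λ c≡j → <-irrefl (sym c≡j) j<c))))

  -- The m+1-j entries after position j are distinct and smaller than π a.
  front-large : ∀ {a} → a < j → suc m ∸ j ≤ at π a
  front-large {a} a<j = injective-into-interval (λ k → at π (suc j + k)) into
    (λ k< k′< e → +-cancelˡ-≡ (suc j) _ _ (injective (after-j k<) (after-j k′<) e))
    where
      after-j : ∀ {k} → k < suc m ∸ j → suc j + k < suc (suc m)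
      after-j {k} k< = s≤s (subst (_≤ suc m) (+-suc j k) (subst (j + suc k ≤_) (m+[n∸m]≡n (m≤n⇒m≤1+n j≤m)) (+-monoʳ-≤ j k<)))
      into : ∀ {k} → k < suc m ∸ j → 0 ≤ at π (suc j + k) × at π (suc j + k) < at π a
      into k< = z≤n , front-above-back a<j (s≤s (m≤m+n j _)) (after-j k<)

  -- The j entries before position j are distinct and lie strictly between π c and m+1.
  back-small : ∀ {c} → j < c → c < suc (suc m) → j + at π c ≤ m
  back-small {c} j<c c< = m≤o∸n⇒m+n≤o j πc≤m
    (injective-into-interval (at π) into (λ a< a′< → injective (<-trans a< j<2+m) (<-trans a′< j<2+m)))
    where
      πc≤m : at π c ≤ m
      πc≤m = s≤s⁻¹ (value<top c< (λ c≡j → <-irrefl (sym c≡j) j<c))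
      into : ∀ {a} → a < j → suc (at π c) ≤ at π a × at π a < suc m
      into a<j = front-above-back a<j j<c c< , value<top (<-trans a<j j<2+m) (<⇒≢ a<j)

  j+j≤m : j + j ≤ m
  j+j≤m = back-small (s≤s j≤m) last<2+m

  swapsEnds : SwapsEnds m σ j
  swapsEnds = record { front↦back = front↦back ; back↦front = back↦front }
    where
      front↦back : ∀ {i} → i < j → m ∸ j ≤ at σ i
      front↦back {i} i<j = begin
        m ∸ j                    ≡⟨ cong pred (sym (+-∸-assoc 1 j≤m)) ⟩
        pred (suc m ∸ j)         ≤⟨ pred-mono-≤ (front-large i<j) ⟩
        pred (at π i)            ≡⟨ sym (unshift-≥ (<⇒≤ j<πi)) ⟩
        unshift j (at π i)       ≡⟨ cong (unshift j ∘ at π) (sym (shift-< i<j)) ⟩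
        unshift j (at π (shift j i)) ≡⟨ sym (at-σ (<-≤-trans i<j j≤m)) ⟩
        at σ i                   ∎
        where
          open ≤-Reasoning
          j<πi : j < at π i
          j<πi = front-above-back i<j (s≤s j≤m) last<2+m

      back↦front : ∀ {i} → i < m → m ∸ j ≤ i → at σ i < j
      back↦front {i} i<m m∸j≤i = subst (_< j) (sym σi≡) πp<j
        where
          j≤i : j ≤ i
          j≤i = ≤-trans (m+n≤o⇒m≤o∸n j j+j≤m) m∸j≤i
          p<2+m : suc i < suc (suc m)
          p<2+m = s≤s (m<n⇒m<1+n i<m)
          πp<j : at π (suc i) < j
          πp<j with <-cmp (at π (suc i)) j
          ... | tri< πp<j _ _ = πp<j
          ... | tri≈ _ πp≡j _ = ⊥-elim (value≢j p<2+m (λ e → <-irrefl e (s≤s i<m)) πp≡j)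
          ... | tri> _ _ j<πp = ⊥-elim (<⇒≱ j+i<m (≤-trans (m≤n+m∸n m j) (+-monoʳ-≤ j m∸j≤i)))
            where
              j+i<m : j + i < m
              j+i<m = subst (_≤ m) (+-suc j i)
                        (subst (λ x → j + x ≤ m) (involutive p<2+m) (back-small j<πp (bounded p<2+m)))
          σi≡ : at σ i ≡ at π (suc i)
          σi≡ = trans (at-σ i<m) (trans (cong (unshift j ∘ at π) (shift-≥ j≤i)) (unshift-< πp<j))

swapsEnds? : ∀ m σ j → Dec (SwapsEnds m σ j)
swapsEnds? m σ j =
  map′ (uncurry mkSwapsEnds) (λ S → SwapsEnds.front↦back S , SwapsEnds.back↦front S)
       (allUpTo? (λ i → m ∸ j ≤? at σ i) j ×-dec allUpTo? (λ i → m ∸ j ≤? i →-dec at σ i <? j) m)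

swapsEnds-zero : ∀ m σ → SwapsEnds m σ 0
swapsEnds-zero m σ = mkSwapsEnds (λ ()) (λ i<m m≤i → ⊥-elim (<⇒≱ i<m m≤i))

splitPoints : List ℕ → List ℕ
splitPoints σ = filter (swapsEnds? (length σ) σ) (applyUpTo suc ⌊ length σ /2⌋)

splitCount : List ℕ → ℕ
splitCount σ = length (splitPoints σ)

splitCount≤ : ∀ σ → splitCount σ ≤ ⌊ length σ /2⌋
splitCount≤ σ = ≤-trans (length-filter (swapsEnds? (length σ) σ) (applyUpTo suc ⌊ length σ /2⌋))
                        (≤-reflexive (length-applyUpTo suc ⌊ length σ /2⌋))

insertionPoints : List ℕ → List ℕ
insertionPoints σ = 0 ∷ splitPoints σ

insertionPoints≡filter : ∀ {m σ} → length σ ≡ m → insertionPoints σ ≡ filter (swapsEnds? m σ) (upTo (suc ⌊ m /2⌋))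
insertionPoints≡filter {σ = σ} refl = sym (filter-accept (swapsEnds? (length σ) σ) (swapsEnds-zero (length σ) σ))

splitPoints≡filter : ∀ {n π} → length π ≡ n → splitPoints π ≡ filter (swapsEnds? n π) (applyUpTo suc ⌊ n /2⌋)
splitPoints≡filter refl = refl

∈-insertionPoints⁻ : ∀ {m σ j} → length σ ≡ m → j ∈ insertionPoints σ → j + j ≤ m × SwapsEnds m σ j
∈-insertionPoints⁻ {σ = σ} {j} refl j∈
  with ∈-filter⁻ (swapsEnds? (length σ) σ) {xs = upTo _} (subst (j ∈_) (insertionPoints≡filter {σ = σ} refl) j∈)
... | j∈upTo , S = ≤⌊/2⌋⇒+≤ (s≤s⁻¹ (∈-upTo⁻ j∈upTo)) , S

∈-insertionPoints⁺ : ∀ {m σ j} → length σ ≡ m → j + j ≤ m → SwapsEnds m σ j → j ∈ insertionPoints σ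
∈-insertionPoints⁺ {σ = σ} {j} refl j+j≤m S = subst (j ∈_) (sym (insertionPoints≡filter {σ = σ} refl))
  (∈-filter⁺ (swapsEnds? (length σ) σ) (∈-upTo⁺ (s≤s (+≤⇒≤⌊/2⌋ j+j≤m))) S)

insertionPoints-unique : ∀ σ → Unique (insertionPoints σ)
insertionPoints-unique σ = subst Unique (sym (insertionPoints≡filter {σ = σ} refl))
  (Uniqueₚ.filter⁺ (swapsEnds? (length σ) σ) (Uniqueₚ.upTo⁺ _))

insertionPoint≤length : ∀ {σ j} → j ∈ insertionPoints σ → j ≤ length σ
insertionPoint≤length {σ} j∈ = ≤-trans (m≤m+n _ _) (proj₁ (∈-insertionPoints⁻ {σ = σ} refl j∈))

cycleInsertions : List ℕ → List (List ℕ)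
cycleInsertions σ = map (insertCycle σ) (insertionPoints σ)

involutions132 : ℕ → List (List ℕ)
involutions132 zero          = [ [] ]
involutions132 (suc zero)    = [ [ 0 ] ]
involutions132 (suc (suc m)) = map appendFixed (involutions132 (suc m)) ++ concatMap cycleInsertions (involutions132 m)

∈-concatMap⁻ : ∀ {A B : Set} (f : A → List B) {xs y} → y ∈ concatMap f xs → ∃ λ x → x ∈ xs × y ∈ f x
∈-concatMap⁻ f {xs} y∈ = find (Anyₚ.map⁻ (∈-concat⁻ (map f xs) y∈))

ListsOnly132Involutions ListsAll132Involutions : ℕ → Set
ListsOnly132Involutions n = ∀ {π} → π ∈ involutions132 n → IsInvolutionℕ n π × Avoids132ℕ n π
ListsAll132Involutions n  = ∀ {π} → IsInvolutionℕ n π → Avoids132ℕ n π → π ∈ involutions132 n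

involutions132-sound-step : ∀ m → ListsOnly132Involutions (suc m) → ListsOnly132Involutions m → ListsOnly132Involutions (suc (suc m))
involutions132-sound-step m sound₁ sound₀ π∈ with ∈-++⁻ (map appendFixed (involutions132 (suc m))) π∈
... | inj₁ π∈fixed with ∈-map⁻ appendFixed π∈fixed
...   | σ , σ∈ , refl = let I , av = sound₁ σ∈ in appendFixed-involution I , appendFixed-avoids I av
involutions132-sound-step m sound₁ sound₀ π∈ | inj₂ π∈cycle with ∈-concatMap⁻ cycleInsertions {involutions132 m} π∈cycle
... | σ , σ∈ , π∈σ with ∈-map⁻ (insertCycle σ) π∈σ
...   | j , j∈ , refl =
  let I , av = sound₀ σ∈
      j+j≤m , S = ∈-insertionPoints⁻ (IsInvolutionℕ.length≡ I) j∈
  in insertCycle-involution I (≤-trans (m≤m+n j j) j+j≤m) , InsertCycleAvoids.insertCycle-avoids I av j+j≤m S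

involutions132-sound : ∀ n → ListsOnly132Involutions n
involutions132-sound zero (here refl) =
  record { length≡ = refl ; bounded = λ () ; involutive = λ () } , λ { (_ , _ , _ , _ , _ , () , _) }
involutions132-sound (suc zero) (here refl) =
  record { length≡ = refl ; bounded = λ { z<s → z<s } ; involutive = λ { z<s → refl } } ,
  λ { (_ , _ , _ , _ , b<c , s≤s c≤0 , _) → n≮0 (<-≤-trans b<c c≤0) }
involutions132-sound (suc (suc m)) =
  involutions132-sound-step m (involutions132-sound (suc m)) (involutions132-sound m)

involutions132-complete-step : ∀ m → ListsAll132Involutions (suc m) → ListsAll132Involutions m → ListsAll132Involutions (suc (suc m))
involutions132-complete-step m complete₁ complete₀ {π} I av with at π (suc m) ≟ suc m
... | yes fixed = ∈-++⁺ˡ (subst (_∈ _) reassemble (∈-map⁺ appendFixed (complete₁ involution (avoids av))))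
  where open RemoveFixed I fixed
... | no moved = ∈-++⁺ʳ _ (subst (_∈ _) reassemble (∈-concat⁺′
                   (∈-map⁺ (insertCycle σ) (∈-insertionPoints⁺ (IsInvolutionℕ.length≡ involution) j+j≤m swapsEnds))
                   (∈-map⁺ cycleInsertions (complete₀ involution avoids))))
  where open RemoveCycle I av moved

involutions132-complete : ∀ n → ListsAll132Involutions n
involutions132-complete zero {[]} I av = here refl
involutions132-complete (suc zero) {x ∷ []} I av with IsInvolutionℕ.bounded I {0} z<s
... | s≤s z≤n = here refl
involutions132-complete (suc (suc m)) =
  involutions132-complete-step m (involutions132-complete (suc m)) (involutions132-complete m)

appendFixed-injective : ∀ {σ τ} → appendFixed σ ≡ appendFixed τ → σ ≡ τ
appendFixed-injective {σ} {τ} e = proj₁ (∷ʳ-injective σ τ e)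

insertCycle-injectiveʳ : ∀ {σ τ j j′} → insertCycle σ j ≡ insertCycle τ j′ → j ≡ j′
insertCycle-injectiveʳ e = proj₂ (∷ʳ-injective _ _ e)

insertCycle-injectiveˡ : ∀ {σ τ j} → j ≤ length σ → j ≤ length τ → insertCycle σ j ≡ insertCycle τ j → σ ≡ τ
insertCycle-injectiveˡ {σ} {τ} {j} j≤σ j≤τ e = ≡-by-at (suc-injective (suc-injective length-eq)) pointwise
  where
    module S = InsertCycle σ refl j≤σ
    module T = InsertCycle τ refl j≤τ
    length-eq : suc (suc (length σ)) ≡ suc (suc (length τ))
    length-eq = trans (sym S.length-insertCycle) (trans (cong length e) T.length-insertCycle)
    i<τ : ∀ {i} → i < length σ → i < length τ
    i<τ = subst (_ <_) (suc-injective (suc-injective length-eq))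
    pointwise : ∀ {i} → i < length σ → at σ i ≡ at τ i
    pointwise {i} i< = begin
      at σ i                                   ≡⟨ unshift-shift j (at σ i) ⟨
      unshift j (shift j (at σ i))             ≡⟨ cong (unshift j) (S.at-shift i<) ⟨
      unshift j (at (insertCycle σ j) (shift j i)) ≡⟨ cong (λ π → unshift j (at π (shift j i))) e ⟩
      unshift j (at (insertCycle τ j) (shift j i)) ≡⟨ cong (unshift j) (T.at-shift (i<τ i<)) ⟩
      unshift j (shift j (at τ i))             ≡⟨ unshift-shift j (at τ i) ⟩
      at τ i                                   ∎
      where open ≡-Reasoning

appendFixed≢insertCycle : ∀ {σ τ j} → j ≤ length τ → appendFixed σ ≢ insertCycle τ j
appendFixed≢insertCycle {σ} {τ} {j} j≤τ e = <-irrefl (sym length≡j) (subst (j <_) (sym (suc-injective length-eq)) (s≤s j≤τ))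
  where
    length≡j : length σ ≡ j
    length≡j = proj₂ (∷ʳ-injective σ _ e)
    length-eq : suc (length σ) ≡ suc (suc (length τ))
    length-eq = trans (sym (AppendFixed.length-appendFixed σ refl))
                  (trans (cong length e) (InsertCycle.length-insertCycle τ refl j≤τ))

cycleInsertions-unique : ∀ σ → Unique (cycleInsertions σ)
cycleInsertions-unique σ = Uniqueₚ.map⁺ insertCycle-injectiveʳ (insertionPoints-unique σ)

cycleInsertions-disjoint : ∀ {σ τ} → σ ≢ τ → Disjoint (cycleInsertions σ) (cycleInsertions τ)
cycleInsertions-disjoint {σ} {τ} σ≢τ (π∈σ , π∈τ) with ∈-map⁻ (insertCycle σ) π∈σ | ∈-map⁻ (insertCycle τ) π∈τ
... | j , j∈ , refl | j′ , j′∈ , e with insertCycle-injectiveʳ {σ} {τ} e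
... | refl = σ≢τ (insertCycle-injectiveˡ (insertionPoint≤length {σ} j∈) (insertionPoint≤length {τ} j′∈) e)

appendFixed-cycleInsertions-disjoint : ∀ xs ys → Disjoint (map appendFixed xs) (concatMap cycleInsertions ys)
appendFixed-cycleInsertions-disjoint xs ys (π∈fixed , π∈cycle)
  with ∈-map⁻ appendFixed π∈fixed | ∈-concatMap⁻ cycleInsertions {ys} π∈cycle
... | σ , _ , refl | τ , _ , π∈τ with ∈-map⁻ (insertCycle τ) π∈τ
...   | j , j∈ , e = appendFixed≢insertCycle (insertionPoint≤length {τ} j∈) e

involutions132-unique : ∀ n → Unique (involutions132 n)
involutions132-unique zero          = All.[] AllPairs.∷ AllPairs.[]
involutions132-unique (suc zero)    = All.[] AllPairs.∷ AllPairs.[]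
involutions132-unique (suc (suc m)) = Uniqueₚ.++⁺
  (Uniqueₚ.map⁺ appendFixed-injective (involutions132-unique (suc m)))
  (Uniqueₚ.concat⁺ (Allₚ.map⁺ (All.tabulate (λ {σ} _ → cycleInsertions-unique σ)))
                  (AllPairsₚ.map⁺ (AllPairs.map cycleInsertions-disjoint (involutions132-unique m))))
  (appendFixed-cycleInsertions-disjoint (involutions132 (suc m)) (involutions132 m))

-- Rises

riseℕ : ℕ → ℕ → ℕ
riseℕ x y = 𝟙 (x <? y)

risesFromℕ : ℕ → List ℕ → ℕ
risesFromℕ x []       = 0
risesFromℕ x (y ∷ ys) = riseℕ x y + risesFromℕ y ys

risesℕ : List ℕ → ℕ
risesℕ []       = 0
risesℕ (x ∷ xs) = risesFromℕ x xs

riseℕ-shift : ∀ j x y → riseℕ (shift j x) (shift j y) ≡ riseℕ x y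
riseℕ-shift j x y = 𝟙-cong (shift j x <? shift j y) (x <? y) (shift-cancel-< j) (shift-mono-< j)

risesℕ-map-shift : ∀ j xs → risesℕ (map (shift j) xs) ≡ risesℕ xs
risesℕ-map-shift j []       = refl
risesℕ-map-shift j (x ∷ xs) = go x xs
  where
    go : ∀ x ys → risesFromℕ (shift j x) (map (shift j) ys) ≡ risesFromℕ x ys
    go x []       = refl
    go x (y ∷ ys) = cong₂ _+_ (riseℕ-shift j x y) (go y ys)

risesℕ-++ : ∀ xs ys → 0 < length xs → 0 < length ys →
            risesℕ (xs ++ ys) ≡ risesℕ xs + riseℕ (last xs) (at ys 0) + risesℕ ys
risesℕ-++ (x ∷ xs) (y ∷ ys) _ _ = trans (go x xs) (sym (+-assoc (risesFromℕ x xs) _ _))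
  where
    go : ∀ x xs → risesFromℕ x (xs ++ y ∷ ys) ≡ risesFromℕ x xs + (riseℕ (last (x ∷ xs)) y + risesFromℕ y ys)
    go x []        = refl
    go x (x′ ∷ xs) = trans (cong (riseℕ x x′ +_) (go x′ xs)) (sym (+-assoc (riseℕ x x′) _ _))

risesℕ-∷ʳ : ∀ xs z → 0 < length xs → risesℕ (xs ∷ʳ z) ≡ risesℕ xs + riseℕ (last xs) z
risesℕ-∷ʳ xs z 0<xs = trans (risesℕ-++ xs [ z ] 0<xs z<s) (+-identityʳ _)

risesℕ-∷ : ∀ y ys → 0 < length ys → risesℕ (y ∷ ys) ≡ riseℕ y (at ys 0) + risesℕ ys
risesℕ-∷ y ys 0<ys = risesℕ-++ [ y ] ys z<s 0<ys

risesℕ-split-at-descent : ∀ xs {j} → 0 < j → j < length xs → at xs j ≤ at xs (pred j) →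
                          risesℕ xs ≡ risesℕ (take j xs) + risesℕ (drop j xs)
risesℕ-split-at-descent xs {j} 0<j j<xs descent = begin
  risesℕ xs                                               ≡⟨ cong risesℕ (take++drop≡id j xs) ⟨
  risesℕ (take j xs ++ drop j xs)                         ≡⟨ risesℕ-++ (take j xs) (drop j xs) 0<take 0<drop ⟩
  risesℕ (take j xs) + riseℕ (last (take j xs)) (at (drop j xs) 0) + risesℕ (drop j xs)
                                                          ≡⟨ cong (λ r → risesℕ (take j xs) + r + risesℕ (drop j xs)) boundary ⟩
  risesℕ (take j xs) + 0 + risesℕ (drop j xs)             ≡⟨ cong (_+ risesℕ (drop j xs)) (+-identityʳ _) ⟩
  risesℕ (take j xs) + risesℕ (drop j xs)                 ∎
  where
    open ≡-Reasoning
    0<take : 0 < length (take j xs)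
    0<take = subst (0 <_) (sym (length-take≤ xs (<⇒≤ j<xs))) 0<j
    0<drop : 0 < length (drop j xs)
    0<drop = subst (0 <_) (sym (length-drop j xs)) (m<n⇒0<n∸m j<xs)
    boundary : riseℕ (last (take j xs)) (at (drop j xs) 0) ≡ 0
    boundary = 𝟙-no _ (subst₂ (λ x y → ¬ x < y) (sym (last-take xs 0<j (<⇒≤ j<xs))) (sym (at-drop-0 j xs)) (≤⇒≯ descent))

risesℕ-appendFixed : ∀ {m σ} → IsInvolutionℕ (suc m) σ → risesℕ (appendFixed σ) ≡ suc (risesℕ σ)
risesℕ-appendFixed {m} {σ} I = begin
  risesℕ (appendFixed σ)                              ≡⟨ risesℕ-∷ʳ σ (length σ) 0<σ ⟩
  risesℕ σ + riseℕ (last σ) (length σ)                ≡⟨ cong (risesℕ σ +_) (𝟙-yes _ last<length) ⟩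
  risesℕ σ + 1                                        ≡⟨ +-comm (risesℕ σ) 1 ⟩
  suc (risesℕ σ)                                      ∎
  where
    open ≡-Reasoning
    open IsInvolutionℕ I
    0<σ : 0 < length σ
    0<σ = subst (0 <_) (sym length≡) z<s
    last<length : last σ < length σ
    last<length = subst (last σ <_) (sym length≡) (bounded (subst (λ n → pred n < suc m) (sym length≡) ≤-refl))

risesℕ-insertCycle-zero : ∀ {m σ} → IsInvolutionℕ m σ → risesℕ (insertCycle σ 0) ≡ risesℕ σ
risesℕ-insertCycle-zero {σ = []}    I = refl
risesℕ-insertCycle-zero {σ = x ∷ σ′} I = begin
  riseℕ (suc (length σ)) (shift 0 x) + risesℕ (map (shift 0) σ ∷ʳ 0)
                                    ≡⟨ cong₂ _+_ top-first (risesℕ-∷ʳ (map (shift 0) σ) 0 z<s) ⟩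
  0 + (risesℕ (map (shift 0) σ) + riseℕ (last (map (shift 0) σ)) 0)
                                    ≡⟨ cong₂ _+_ (risesℕ-map-shift 0 σ) (𝟙-no (last (map (shift 0) σ) <? 0) n≮0) ⟩
  risesℕ σ + 0                      ≡⟨ +-identityʳ (risesℕ σ) ⟩
  risesℕ σ                          ∎
  where
    open ≡-Reasoning
    σ = x ∷ σ′
    top-first : riseℕ (suc (length σ)) (shift 0 x) ≡ 0
    top-first = 𝟙-no _ (≤⇒≯ (≤-trans (shift≤suc 0 x) (m≤n⇒m≤1+n x<length)))
      where
        open IsInvolutionℕ I
        x<length : x < length σ
        x<length = subst (x <_) (sym length≡) (bounded (subst (0 <_) length≡ z<s))

module InsertCycleRises {m σ j} (I : IsInvolutionℕ m σ) (0<j : 0 < j) (j+j≤m : j + j ≤ m) (S : SwapsEnds m σ j) where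

  open IsInvolutionℕ I
  open SwapsEnds S
  open SwapsEndsInvolution I S

  private
    j<m : j < m
    j<m = <-≤-trans (m<m+n j 0<j) j+j≤m

    j<σ : j < length σ
    j<σ = subst (j <_) (sym length≡) j<m

    front back : List ℕ
    front = map (shift j) (take j σ)
    back  = map (shift j) (drop j σ)

    0<front : 0 < length front
    0<front = subst (0 <_) (sym (trans (length-map _ (take j σ)) (length-take≤ σ (<⇒≤ j<σ)))) 0<j

    0<drop : 0 < length (drop j σ)
    0<drop = subst (0 <_) (sym (length-drop j σ)) (m<n⇒0<n∸m j<σ)

    0<back : 0 < length back
    0<back = subst (0 <_) (sym (length-map _ (drop j σ))) 0<drop

    shape : insertCycle σ j ≡ front ++ suc (length σ) ∷ (back ∷ʳ j)
    shape = ++-assoc front (suc (length σ) ∷ back) [ j ]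

    shifted≤m : ∀ {i} → i < m → shift j (at σ i) ≤ m
    shifted≤m i<m = ≤-trans (shift≤suc j _) (bounded i<m)

    rise-into-top : riseℕ (last front) (suc (length σ)) ≡ 1
    rise-into-top = 𝟙-yes _ (subst₂ _<_ (sym last≡) (cong suc (sym length≡)) (s≤s (shifted≤m (<-trans (pred<self 0<j) j<m))))
      where
        last≡ : last front ≡ shift j (at σ (pred j))
        last≡ = trans (last-map (shift j) (take j σ) (subst (0 <_) (length-map (shift j) (take j σ)) 0<front))
                      (cong (shift j) (last-take σ 0<j (<⇒≤ j<σ)))

    rise-from-top : riseℕ (suc (length σ)) (at (back ∷ʳ j) 0) ≡ 0
    rise-from-top = 𝟙-no _ (≤⇒≯ (subst₂ _≤_ (sym head≡) (cong suc (sym length≡)) (m≤n⇒m≤1+n (shifted≤m j<m))))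
      where
        head≡ : at (back ∷ʳ j) 0 ≡ shift j (at σ j)
        head≡ = trans (at-++ˡ back [ j ] 0<back) (trans (at-map (shift j) (drop j σ) 0<drop) (cong (shift j) (at-drop-0 j σ)))

    rise-into-j : riseℕ (last back) j ≡ 1
    rise-into-j = 𝟙-yes _ (subst (_< j) (sym last≡) σ-last<j)
      where
        pred-m<m : pred m < m
        pred-m<m = pred<self (<-trans 0<j j<m)
        σ-last<j : at σ (pred m) < j
        σ-last<j = back↦front pred-m<m (∸-monoʳ-≤ m 0<j)
        last≡ : last back ≡ at σ (pred m)
        last≡ = begin
          last back                      ≡⟨ last-map (shift j) (drop j σ) 0<drop ⟩
          shift j (last (drop j σ))      ≡⟨ cong (shift j) (last-drop j σ j<σ) ⟩
          shift j (last σ)               ≡⟨ cong (λ n → shift j (at σ (pred n))) length≡ ⟩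
          shift j (at σ (pred m))        ≡⟨ shift-< σ-last<j ⟩
          at σ (pred m)                  ∎
          where open ≡-Reasoning

    descent : at σ j ≤ at σ (pred j)
    descent = <⇒≤ (<-≤-trans (non-front⇒small-value j<m ≤-refl) (front↦back (pred<self 0<j)))

  risesℕ-insertCycle : risesℕ (insertCycle σ j) ≡ 2 + risesℕ σ
  risesℕ-insertCycle = begin
    risesℕ (insertCycle σ j)
      ≡⟨ cong risesℕ shape ⟩
    risesℕ (front ++ M ∷ (back ∷ʳ j))
      ≡⟨ risesℕ-++ front _ 0<front z<s ⟩
    risesℕ front + riseℕ (last front) M + risesℕ (M ∷ (back ∷ʳ j))
      ≡⟨ cong (risesℕ front + riseℕ (last front) M +_) (risesℕ-∷ M (back ∷ʳ j) 0<back∷ʳj) ⟩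
    risesℕ front + riseℕ (last front) M + (riseℕ M (at (back ∷ʳ j) 0) + risesℕ (back ∷ʳ j))
      ≡⟨ cong (λ r → risesℕ front + riseℕ (last front) M + (riseℕ M (at (back ∷ʳ j) 0) + r)) (risesℕ-∷ʳ back j 0<back) ⟩
    risesℕ front + riseℕ (last front) M + (riseℕ M (at (back ∷ʳ j) 0) + (risesℕ back + riseℕ (last back) j))
      ≡⟨ cong₂ _+_ (cong₂ _+_ (risesℕ-map-shift j (take j σ)) rise-into-top)
                               (cong₂ _+_ rise-from-top (cong₂ _+_ (risesℕ-map-shift j (drop j σ)) rise-into-j)) ⟩
    risesℕ (take j σ) + 1 + (0 + (risesℕ (drop j σ) + 1))
      ≡⟨ solve 2 (λ a b → a :+ con 1 :+ (b :+ con 1) := con 2 :+ (a :+ b)) refl (risesℕ (take j σ)) (risesℕ (drop j σ)) ⟩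
    2 + (risesℕ (take j σ) + risesℕ (drop j σ))
      ≡⟨ cong (2 +_) (risesℕ-split-at-descent σ 0<j j<σ descent) ⟨
    2 + risesℕ σ
      ∎
    where
      open ≡-Reasoning
      M = suc (length σ)
      0<back∷ʳj : 0 < length (back ∷ʳ j)
      0<back∷ʳj = subst (0 <_) (sym (length-++ back)) (≤-trans 0<back (m≤m+n _ _))

splitPoints-increasing : ∀ σ → AllPairs _<_ (splitPoints σ)
splitPoints-increasing σ = AllPairsₚ.filter⁺ (swapsEnds? (length σ) σ) (AllPairsₚ.applyUpTo⁺₁ suc ⌊ length σ /2⌋ (λ i<j _ → s≤s i<j))

splitPoints-positive : ∀ σ {j} → j ∈ splitPoints σ → 0 < j
splitPoints-positive σ j∈
  with ∈-applyUpTo⁻ suc {n = H} (proj₁ (∈-filter⁻ (swapsEnds? (length σ) σ) {xs = applyUpTo suc H} j∈))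
  where H = ⌊ length σ /2⌋
... | _ , _ , refl = z<s

splitCount-appendFixed : ∀ σ → splitCount (appendFixed σ) ≡ 0
splitCount-appendFixed σ = cong length (trans (splitPoints≡filter (length-appendFixed)) (filter-none _ (All.tabulate no-split)))
  where
    open AppendFixed σ refl
    L = length σ
    no-split : ∀ {j} → j ∈ applyUpTo suc ⌊ suc L /2⌋ → ¬ SwapsEnds (suc L) (appendFixed σ) j
    no-split j∈ S with ∈-applyUpTo⁻ suc j∈
    ... | i , i<⌊⌋ , refl = <⇒≱ (<-≤-trans i<⌊⌋ (s≤s⁻¹ (⌊n/2⌋<n L)))
                                 (s≤s⁻¹ (subst (_< suc i) at-appendFixed-last (SwapsEnds.back↦front S ≤-refl (m∸n≤m L i))))

module InsertCycleSplits {m} {σ : List ℕ} (len : length σ ≡ m) {j} (j≤m : j ≤ m) {x} (x+x≤m : x + x ≤ m) where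

  open InsertCycle σ len j≤m

  private
    π = insertCycle σ j

    x≤m∸x : x ≤ m ∸ x
    x≤m∸x = m+n≤o⇒m≤o∸n x x+x≤m

    x≤m : x ≤ m
    x≤m = ≤-trans (m≤m+n x x) x+x≤m

    1+m∸x : suc m ∸ x ≡ suc (m ∸ x)
    1+m∸x = +-∸-assoc 1 x≤m

  split⇒ : SwapsEnds (suc (suc m)) π (suc x) → j ≤ x × SwapsEnds m σ x
  split⇒ (mkSwapsEnds front↦back back↦front) = j≤x , mkSwapsEnds front↦back′ back↦front′
    where
      j≤x : j ≤ x
      j≤x = s≤s⁻¹ (subst (_< suc x) at-last (back↦front ≤-refl (m∸n≤m (suc m) x)))

      front↦back′ : ∀ {i} → i < x → m ∸ x ≤ at σ i
      front↦back′ {i} i<x = s≤s⁻¹ (begin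
        suc (m ∸ x)             ≡⟨ 1+m∸x ⟨
        suc m ∸ x               ≤⟨ front↦back (s≤s (≤-trans (shift≤suc j i) i<x)) ⟩
        at π (shift j i)        ≡⟨ at-shift (<-≤-trans i<x x≤m) ⟩
        shift j (at σ i)        ≤⟨ shift≤suc j _ ⟩
        suc (at σ i)            ∎)
        where open ≤-Reasoning

      back↦front′ : ∀ {i} → i < m → m ∸ x ≤ i → at σ i < x
      back↦front′ {i} i<m m∸x≤i with at σ i <? j
      ... | yes σi<j = <-≤-trans σi<j j≤x
      ... | no  σi≮j = s≤s⁻¹ (subst (_< suc x) (trans (at-back j≤i i<m) (shift-≥ (≮⇒≥ σi≮j)))
                         (back↦front (s≤s (m<n⇒m<1+n i<m)) (subst (_≤ suc i) (sym 1+m∸x) (s≤s m∸x≤i))))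
        where
          j≤i : j ≤ i
          j≤i = ≤-trans j≤x (≤-trans x≤m∸x m∸x≤i)

  split⇐ : j ≤ x → SwapsEnds m σ x → SwapsEnds (suc (suc m)) π (suc x)
  split⇐ j≤x (mkSwapsEnds front↦back back↦front) = mkSwapsEnds front↦back′ back↦front′
    where
      front↦back′ : ∀ {p} → p < suc x → suc m ∸ x ≤ at π p
      front↦back′ p<1+x with position (<-≤-trans p<1+x (s≤s (m≤n⇒m≤1+n x≤m)))
      ... | cycle-start refl = subst (suc m ∸ x ≤_) (sym at-j) (m∸n≤m (suc m) x)
      ... | cycle-end   refl = ⊥-elim (<⇒≱ p<1+x (s≤s x≤m))
      ... | shifted {i} i<m refl = begin
        suc m ∸ x            ≡⟨ 1+m∸x ⟩
        suc (m ∸ x)          ≤⟨ s≤s (front↦back i<x) ⟩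
        suc (at σ i)         ≡⟨ shift-≥ (≤-trans j≤x (≤-trans x≤m∸x (front↦back i<x))) ⟨
        shift j (at σ i)     ≡⟨ at-shift i<m ⟨
        at π (shift j i)     ∎
        where
          open ≤-Reasoning
          i<x : i < x
          i<x = shift-<-suc j≤x p<1+x

      back↦front′ : ∀ {p} → p < suc (suc m) → suc m ∸ x ≤ p → at π p < suc x
      back↦front′ p<2+m 1+m∸x≤p with position p<2+m
      ... | cycle-start refl = ⊥-elim (<⇒≱ (≤-trans (s≤s (≤-trans j≤x x≤m∸x)) (≤-reflexive (sym 1+m∸x))) 1+m∸x≤p)
      ... | cycle-end   refl = subst (_< suc x) (sym at-last) (s≤s j≤x)
      ... | shifted {i} i<m refl = subst (_< suc x) (sym (at-shift i<m))
                                     (s≤s (≤-trans (shift≤suc j _) (back↦front i<m m∸x≤i)))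
        where
          m∸x≤i : m ∸ x ≤ i
          m∸x≤i = s≤s⁻¹ (≤-trans (≤-reflexive (sym 1+m∸x)) (≤-trans 1+m∸x≤p (shift≤suc j i)))

  𝟙-split : 𝟙 (swapsEnds? (suc (suc m)) π (suc x)) ≡ 𝟙 (j ≤? x) * 𝟙 (swapsEnds? m σ x)
  𝟙-split = trans (𝟙-cong _ ((j ≤? x) ×-dec swapsEnds? m σ x) split⇒ (λ (j≤x , S) → split⇐ j≤x S))
                  (𝟙-×-dec (j ≤? x) (swapsEnds? m σ x))

splitCount-insertCycle : ∀ {m} σ j → length σ ≡ m → j + j ≤ m →
                         splitCount (insertCycle σ j) ≡ length (filter (j ≤?_) (insertionPoints σ))
splitCount-insertCycle {m} σ j len j+j≤m = begin
  splitCount π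
    ≡⟨ cong length (splitPoints≡filter {π = π} length-insertCycle) ⟩
  length (filter (swapsEnds? N π) (applyUpTo suc (suc H)))
    ≡⟨ length-filter≡∑ (swapsEnds? N π) (applyUpTo suc (suc H)) ⟩
  ∑ (𝟙 ∘ swapsEnds? N π) (applyUpTo suc (suc H))
    ≡⟨ cong (∑ (𝟙 ∘ swapsEnds? N π)) (map-applyUpTo (λ x → x) suc (suc H)) ⟨
  ∑ (𝟙 ∘ swapsEnds? N π) (map suc (upTo (suc H)))
    ≡⟨ ∑-map (𝟙 ∘ swapsEnds? N π) suc (upTo (suc H)) ⟩
  ∑ (λ x → 𝟙 (swapsEnds? N π (suc x))) (upTo (suc H))
    ≡⟨ ∑-cong (upTo (suc H)) (λ x∈ → InsertCycleSplits.𝟙-split len j≤m (≤⌊/2⌋⇒+≤ (s≤s⁻¹ (∈-upTo⁻ x∈)))) ⟩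
  ∑ (λ x → 𝟙 (j ≤? x) * 𝟙 (swapsEnds? m σ x)) (upTo (suc H))
    ≡⟨ ∑-cong (upTo (suc H)) (λ {x} _ → *-comm (𝟙 (j ≤? x)) _) ⟩
  ∑ (λ x → 𝟙 (swapsEnds? m σ x) * 𝟙 (j ≤? x)) (upTo (suc H))
    ≡⟨ ∑-filter (swapsEnds? m σ) (𝟙 ∘ (j ≤?_)) (upTo (suc H)) ⟨
  ∑ (𝟙 ∘ (j ≤?_)) (filter (swapsEnds? m σ) (upTo (suc H)))
    ≡⟨ cong (∑ (𝟙 ∘ (j ≤?_))) (insertionPoints≡filter len) ⟨
  ∑ (𝟙 ∘ (j ≤?_)) (insertionPoints σ)
    ≡⟨ length-filter≡∑ (j ≤?_) (insertionPoints σ) ⟨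
  length (filter (j ≤?_) (insertionPoints σ))
    ∎
  where
    open ≡-Reasoning
    j≤m : j ≤ m
    j≤m = ≤-trans (m≤m+n j j) j+j≤m
    open InsertCycle σ len j≤m using (length-insertCycle)
    π = insertCycle σ j
    N = suc (suc m)
    H = ⌊ m /2⌋

-- Counting by rises and split points

pascal-*ʳ : ∀ n k c → (n C k) * c + (n C suc k) * c ≡ (suc n C suc k) * c
pascal-*ʳ n k c = trans (sym (*-distribʳ-+ c (n C k) (n C suc k))) (cong (_* c) (nCk+nC[k+1]≡[n+1]C[k+1] n k))

pascal-*ˡ : ∀ c n k → c * (n C k) + c * (n C suc k) ≡ c * (suc n C suc k)
pascal-*ˡ c n k = trans (sym (*-distribˡ-+ c (n C k) (n C suc k))) (cong (c *_) (nCk+nC[k+1]≡[n+1]C[k+1] n k))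

atLeastSplitsFormula excessSplitsFormula : ℕ → ℕ → ℕ → ℕ
atLeastSplitsFormula n r u = ((⌊ n /2⌋ ∸ u) C ⌊ suc r /2⌋) * (⌊ pred n /2⌋ C ⌊ r /2⌋)
excessSplitsFormula  n r u = ((⌊ n /2⌋ ∸ u) C suc ⌊ suc r /2⌋) * (⌊ pred n /2⌋ C ⌊ r /2⌋)

module SolveRecurrence (G K : ℕ → ℕ → ℕ → ℕ)
  (G-zero      : ∀ r → G 0 r 0 ≡ atLeastSplitsFormula 0 r 0)
  (G-one       : ∀ r → G 1 r 0 ≡ atLeastSplitsFormula 1 r 0)
  (G-suc-0     : ∀ m u → G (2 + m) 0 (suc u) ≡ G m 0 u)
  (G-suc-1     : ∀ m u → G (2 + m) 1 (suc u) ≡ G m 1 u)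
  (G-suc-2+    : ∀ m r u → G (2 + m) (2 + r) (suc u) ≡ G m (2 + r) u + K m r u)
  (G-0-0       : ∀ m → G (2 + m) 0 0 ≡ G (2 + m) 0 1)
  (G-0-suc     : ∀ m r → G (2 + m) (suc r) 0 ≡ G (suc m) r 0 + G (2 + m) (suc r) 1)
  (K-peel      : ∀ n r u → K n r u ≡ G n r (suc u) + K n r (suc u))
  (K-vanishes  : ∀ n r u → ⌊ n /2⌋ ≤ u → K n r u ≡ 0)
  where

  Solved : ℕ → Set
  Solved n = (∀ r u → u ≤ ⌊ n /2⌋ → G n r u ≡ atLeastSplitsFormula n r u) × (∀ r u → K n r u ≡ excessSplitsFormula n r u)

  private
    K-large : ∀ n r u → ⌊ n /2⌋ ≤ u → K n r u ≡ excessSplitsFormula n r u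
    K-large n r u h rewrite m≤n⇒m∸n≡0 h = K-vanishes n r u h

    solved-0 : Solved 0
    solved-0 = (λ { r zero _ → G-zero r }) , λ r u → K-large 0 r u z≤n

    solved-1 : Solved 1
    solved-1 = (λ { r zero _ → G-one r }) , λ r u → K-large 1 r u z≤n

  module Step (m : ℕ) (solved₀ : Solved m) (solved₁ : Solved (suc m)) where

    private
      H = ⌊ m /2⌋

    G-suc : ∀ r u → u ≤ H → G (2 + m) r (suc u) ≡ atLeastSplitsFormula (2 + m) r (suc u)
    G-suc zero          u u≤H = trans (G-suc-0 m u) (proj₁ solved₀ 0 u u≤H)
    G-suc (suc zero)    u u≤H = trans (G-suc-1 m u) (proj₁ solved₀ 1 u u≤H)
    G-suc (suc (suc r)) u u≤H =
      trans (G-suc-2+ m r u) (trans (cong₂ _+_ (proj₁ solved₀ (2 + r) u u≤H) (proj₂ solved₀ r u)) (pascal m))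
      where
        pascal : ∀ m → atLeastSplitsFormula m (2 + r) u + excessSplitsFormula m r u ≡ atLeastSplitsFormula (2 + m) (2 + r) (suc u)
        pascal zero rewrite 0∸n≡0 u = refl
        pascal (suc m′) = trans (+-comm (Z * (h C suc ⌊ r /2⌋)) _) (pascal-*ˡ Z h ⌊ r /2⌋)
          where
            h = ⌊ m′ /2⌋
            Z = (⌊ suc m′ /2⌋ ∸ u) C suc ⌊ suc r /2⌋

    G-0 : ∀ r → G (2 + m) r 0 ≡ atLeastSplitsFormula (2 + m) r 0
    G-0 zero    = trans (G-0-0 m) (G-suc 0 0 z≤n)
    G-0 (suc r) = trans (G-0-suc m r) (trans (cong₂ _+_ (proj₁ solved₁ r 0 z≤n) (G-suc (suc r) 0 z≤n)) pascal)
      where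
        H′ = ⌊ suc m /2⌋
        pascal : atLeastSplitsFormula (suc m) r 0 + atLeastSplitsFormula (2 + m) (suc r) 1 ≡ atLeastSplitsFormula (2 + m) (suc r) 0
        pascal = trans (cong (_+ (H C suc ⌊ r /2⌋) * (H′ C ⌊ suc r /2⌋)) (*-comm (H′ C ⌊ suc r /2⌋) _))
                       (pascal-*ʳ H ⌊ r /2⌋ (H′ C ⌊ suc r /2⌋))

    G-all : ∀ r u → u ≤ suc H → G (2 + m) r u ≡ atLeastSplitsFormula (2 + m) r u
    G-all r zero    _         = G-0 r
    G-all r (suc u) (s≤s u≤H) = G-suc r u u≤H

    -- downward induction on u, from u = ⌊(m+2)/2⌋ where both sides vanish
    K-all : ∀ d r u → suc H ≤ d + u → K (2 + m) r u ≡ excessSplitsFormula (2 + m) r u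
    K-all zero    r u h = K-large (2 + m) r u h
    K-all (suc d) r u h with suc H ≤? u
    ... | yes h′ = K-large (2 + m) r u h′
    ... | no  h′ = trans (K-peel (2 + m) r u)
                     (trans (cong₂ _+_ (G-all r (suc u) (≰⇒> h′)) (K-all d r (suc u) (subst (suc H ≤_) (sym (+-suc d u)) h)))
                            pascal)
      where
        a = ⌊ suc r /2⌋
        Y = ⌊ suc m /2⌋ C ⌊ r /2⌋
        pascal : atLeastSplitsFormula (2 + m) r (suc u) + excessSplitsFormula (2 + m) r (suc u) ≡ excessSplitsFormula (2 + m) r u
        pascal = trans (pascal-*ʳ (H ∸ u) a Y) (cong (λ x → (x C suc a) * Y) (sym (+-∸-assoc 1 (s≤s⁻¹ (≰⇒> h′)))))

    solved-2+ : Solved (2 + m)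
    solved-2+ = G-all , λ r u → K-all (suc H) r u (m≤m+n (suc H) u)

  private
    solved-pair : ∀ n → Solved n × Solved (suc n)
    solved-pair zero    = solved-0 , solved-1
    solved-pair (suc n) = proj₂ (solved-pair n) , Step.solved-2+ n (proj₁ (solved-pair n)) (proj₂ (solved-pair n))

  G≡formula : ∀ n r → G n r 0 ≡ atLeastSplitsFormula n r 0
  G≡formula n r = proj₁ (proj₁ (solved-pair n)) r 0 z≤n

atLeastSplits excessSplits : ℕ → ℕ → ℕ → ℕ
atLeastSplits n r u = ∑ (λ σ → 𝟙 (risesℕ σ ≟ r) * 𝟙 (u ≤? splitCount σ)) (involutions132 n)
excessSplits  n r u = ∑ (λ σ → 𝟙 (risesℕ σ ≟ r) * (splitCount σ ∸ u)) (involutions132 n)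

insertionsWith : List ℕ → ℕ → ℕ → ℕ
insertionsWith σ r u = ∑ (λ π → 𝟙 (risesℕ π ≟ r) * 𝟙 (u ≤? splitCount π)) (cycleInsertions σ)

module Insertions {m σ} (I : IsInvolutionℕ m σ) where

  open IsInvolutionℕ I

  private
    splitCount-insertCycle-zero : splitCount (insertCycle σ 0) ≡ suc (splitCount σ)
    splitCount-insertCycle-zero = trans (splitCount-insertCycle σ 0 length≡ z≤n)
      (cong length (filter-all (0 ≤?_) {insertionPoints σ} (All.tabulate (λ _ → z≤n))))

    module AtSplitPoint {j} (j∈ : j ∈ splitPoints σ) where

      0<j : 0 < j
      0<j = splitPoints-positive σ j∈

      j+j≤m×S : j + j ≤ m × SwapsEnds m σ j
      j+j≤m×S = ∈-insertionPoints⁻ length≡ (there j∈)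

      risesℕ≡ : risesℕ (insertCycle σ j) ≡ 2 + risesℕ σ
      risesℕ≡ = InsertCycleRises.risesℕ-insertCycle I 0<j (proj₁ j+j≤m×S) (proj₂ j+j≤m×S)

      splitCount≡ : splitCount (insertCycle σ j) ≡ length (filter (j ≤?_) (splitPoints σ))
      splitCount≡ = trans (splitCount-insertCycle σ j length≡ (proj₁ j+j≤m×S))
                          (cong length (filter-reject (j ≤?_) (<⇒≱ 0<j)))

  insertionsWith-suc : ∀ r u → insertionsWith σ r (suc u) ≡
                       𝟙 (risesℕ σ ≟ r) * 𝟙 (u ≤? splitCount σ) + 𝟙 (2 + risesℕ σ ≟ r) * (splitCount σ ∸ u)
  insertionsWith-suc r u = cong₂ _+_ at-zero (trans (∑-map _ (insertCycle σ) (splitPoints σ)) at-split-points)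
    where
      at-zero : 𝟙 (risesℕ (insertCycle σ 0) ≟ r) * 𝟙 (suc u ≤? splitCount (insertCycle σ 0)) ≡ 𝟙 (risesℕ σ ≟ r) * 𝟙 (u ≤? splitCount σ)
      at-zero = cong₂ _*_ (cong (λ k → 𝟙 (k ≟ r)) (risesℕ-insertCycle-zero I))
                          (trans (cong (λ k → 𝟙 (suc u ≤? k)) splitCount-insertCycle-zero) (𝟙-cong _ (u ≤? splitCount σ) s≤s⁻¹ s≤s))
      c = 𝟙 (2 + risesℕ σ ≟ r)
      at-split-points : ∑ (λ j → 𝟙 (risesℕ (insertCycle σ j) ≟ r) * 𝟙 (suc u ≤? splitCount (insertCycle σ j))) (splitPoints σ)
                        ≡ c * (splitCount σ ∸ u)
      at-split-points = begin
        ∑ (λ j → 𝟙 (risesℕ (insertCycle σ j) ≟ r) * 𝟙 (suc u ≤? splitCount (insertCycle σ j))) (splitPoints σ)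
          ≡⟨ ∑-cong (splitPoints σ) (λ j∈ → cong₂ (λ a b → 𝟙 (a ≟ r) * 𝟙 (suc u ≤? b)) (AtSplitPoint.risesℕ≡ j∈) (AtSplitPoint.splitCount≡ j∈)) ⟩
        ∑ (λ j → c * 𝟙 (u <? length (filter (j ≤?_) (splitPoints σ)))) (splitPoints σ)
          ≡⟨ ∑-*ˡ c _ (splitPoints σ) ⟩
        c * ∑ (λ j → 𝟙 (u <? length (filter (j ≤?_) (splitPoints σ)))) (splitPoints σ)
          ≡⟨ cong (c *_) (∑-long-suffixes u (splitPoints σ) (splitPoints-increasing σ)) ⟩
        c * (splitCount σ ∸ u)
          ∎
        where open ≡-Reasoning

  insertionsWith-zero : ∀ r → insertionsWith σ r 0 ≡ insertionsWith σ r 1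
  insertionsWith-zero r = trans (∑-map _ (insertCycle σ) (insertionPoints σ))
    (trans (∑-cong (insertionPoints σ) (λ {j} j∈ → cong (𝟙 (risesℕ (insertCycle σ j) ≟ r) *_)
             (𝟙-cong (0 ≤? splitCount (insertCycle σ j)) (1 ≤? splitCount (insertCycle σ j)) (λ _ → has-split j∈) (λ _ → z≤n))))
           (sym (∑-map _ (insertCycle σ) (insertionPoints σ))))
    where
      has-split : ∀ {j} → j ∈ insertionPoints σ → 0 < splitCount (insertCycle σ j)
      has-split {j} j∈ = subst (0 <_) (sym (splitCount-insertCycle σ j length≡ (proj₁ (∈-insertionPoints⁻ {σ = σ} length≡ j∈))))
                           (filter-some (j ≤?_) (Any.map ≤-reflexive j∈))

private
  member-involution : ∀ n {σ} → σ ∈ involutions132 n → IsInvolutionℕ n σ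
  member-involution n = proj₁ ∘ involutions132-sound n

  fixedPart : ℕ → ℕ → ℕ → ℕ
  fixedPart m r u = ∑ (λ σ → 𝟙 (risesℕ (appendFixed σ) ≟ r) * 𝟙 (u ≤? splitCount (appendFixed σ))) (involutions132 (suc m))

  atLeastSplits-2+ : ∀ m r u → atLeastSplits (2 + m) r u ≡ fixedPart m r u + ∑ (λ σ → insertionsWith σ r u) (involutions132 m)
  atLeastSplits-2+ m r u = trans (∑-++ f (map appendFixed (involutions132 (suc m))) (concatMap cycleInsertions (involutions132 m)))
    (cong₂ _+_ (∑-map f appendFixed (involutions132 (suc m))) (∑-concatMap f cycleInsertions (involutions132 m)))
    where f = λ σ → 𝟙 (risesℕ σ ≟ r) * 𝟙 (u ≤? splitCount σ)

  fixedPart-suc : ∀ m r u → fixedPart m r (suc u) ≡ 0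
  fixedPart-suc m r u = ∑-zero (involutions132 (suc m)) (λ {σ} _ →
    let c = 𝟙 (risesℕ (appendFixed σ) ≟ r)
    in trans (cong (λ k → c * 𝟙 (suc u ≤? k)) (splitCount-appendFixed σ)) (*-zeroʳ c))

  fixedPart-zero : ∀ m r → fixedPart m r 0 ≡ ∑ (λ σ → 𝟙 (suc (risesℕ σ) ≟ r)) (involutions132 (suc m))
  fixedPart-zero m r = ∑-cong (involutions132 (suc m)) (λ {σ} σ∈ →
    trans (cong₂ (λ a b → 𝟙 (a ≟ r) * 𝟙 (0 ≤? b)) (risesℕ-appendFixed (member-involution (suc m) σ∈)) (splitCount-appendFixed σ))
          (*-identityʳ _))

  atLeastSplits-suc : ∀ m r u → atLeastSplits (2 + m) r (suc u) ≡
                      atLeastSplits m r u + ∑ (λ σ → 𝟙 (2 + risesℕ σ ≟ r) * (splitCount σ ∸ u)) (involutions132 m)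
  atLeastSplits-suc m r u = begin
    atLeastSplits (2 + m) r (suc u)
      ≡⟨ atLeastSplits-2+ m r (suc u) ⟩
    fixedPart m r (suc u) + ∑ (λ σ → insertionsWith σ r (suc u)) (involutions132 m)
      ≡⟨ cong₂ _+_ (fixedPart-suc m r u) (∑-cong (involutions132 m) (λ σ∈ → Insertions.insertionsWith-suc (member-involution m σ∈) r u)) ⟩
    ∑ (λ σ → 𝟙 (risesℕ σ ≟ r) * 𝟙 (u ≤? splitCount σ) + 𝟙 (2 + risesℕ σ ≟ r) * (splitCount σ ∸ u)) (involutions132 m)
      ≡⟨ ∑-+ _ _ (involutions132 m) ⟩
    atLeastSplits m r u + ∑ (λ σ → 𝟙 (2 + risesℕ σ ≟ r) * (splitCount σ ∸ u)) (involutions132 m)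
      ∎
    where open ≡-Reasoning

  atLeastSplits-zero : ∀ m r → atLeastSplits (2 + m) r 0 ≡
                       ∑ (λ σ → 𝟙 (suc (risesℕ σ) ≟ r)) (involutions132 (suc m)) + atLeastSplits (2 + m) r 1
  atLeastSplits-zero m r = begin
    atLeastSplits (2 + m) r 0
      ≡⟨ atLeastSplits-2+ m r 0 ⟩
    fixedPart m r 0 + ∑ (λ σ → insertionsWith σ r 0) (involutions132 m)
      ≡⟨ cong₂ _+_ (fixedPart-zero m r) (∑-cong (involutions132 m) (λ σ∈ → Insertions.insertionsWith-zero (member-involution m σ∈) r)) ⟩
    ∑ (λ σ → 𝟙 (suc (risesℕ σ) ≟ r)) (involutions132 (suc m)) + ∑ (λ σ → insertionsWith σ r 1) (involutions132 m)
      ≡⟨ cong (∑ (λ σ → 𝟙 (suc (risesℕ σ) ≟ r)) (involutions132 (suc m)) +_)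
              (sym (trans (atLeastSplits-2+ m r 1) (cong (_+ insertionPart) (fixedPart-suc m r 0)))) ⟩
    ∑ (λ σ → 𝟙 (suc (risesℕ σ) ≟ r)) (involutions132 (suc m)) + atLeastSplits (2 + m) r 1
      ∎
    where
      open ≡-Reasoning
      insertionPart = ∑ (λ σ → insertionsWith σ r 1) (involutions132 m)

  atLeastSplits-suc-small : ∀ m r u → r < 2 → atLeastSplits (2 + m) r (suc u) ≡ atLeastSplits m r u
  atLeastSplits-suc-small m r u r<2 =
    trans (atLeastSplits-suc m r u) (trans (cong (atLeastSplits m r u +_) (∑-zero (involutions132 m) no-contribution)) (+-identityʳ _))
    where
      no-contribution : ∀ {σ} → σ ∈ involutions132 m → 𝟙 (2 + risesℕ σ ≟ r) * (splitCount σ ∸ u) ≡ 0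
      no-contribution {σ} _ = cong (_* (splitCount σ ∸ u)) (𝟙-no (2 + risesℕ σ ≟ r) (λ e → <⇒≱ r<2 (≤-trans (s≤s (s≤s z≤n)) (≤-reflexive e))))

  atLeastSplits-suc-2+ : ∀ m r u → atLeastSplits (2 + m) (2 + r) (suc u) ≡ atLeastSplits m (2 + r) u + excessSplits m r u
  atLeastSplits-suc-2+ m r u = trans (atLeastSplits-suc m (2 + r) u) (cong (atLeastSplits m (2 + r) u +_)
    (∑-cong (involutions132 m) (λ {σ} _ → cong (_* (splitCount σ ∸ u))
      (𝟙-cong (2 + risesℕ σ ≟ 2 + r) (risesℕ σ ≟ r) (suc-injective ∘ suc-injective) (cong (2 +_))))))

  atLeastSplits-zero-0 : ∀ m → atLeastSplits (2 + m) 0 0 ≡ atLeastSplits (2 + m) 0 1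
  atLeastSplits-zero-0 m = trans (atLeastSplits-zero m 0) (cong (_+ atLeastSplits (2 + m) 0 1)
    (∑-zero (involutions132 (suc m)) (λ {σ} _ → 𝟙-no (suc (risesℕ σ) ≟ 0) (λ ()))))

  atLeastSplits-zero-suc : ∀ m r → atLeastSplits (2 + m) (suc r) 0 ≡ atLeastSplits (suc m) r 0 + atLeastSplits (2 + m) (suc r) 1
  atLeastSplits-zero-suc m r = trans (atLeastSplits-zero m (suc r)) (cong (_+ atLeastSplits (2 + m) (suc r) 1)
    (∑-cong (involutions132 (suc m)) (λ {σ} _ →
      trans (𝟙-cong (suc (risesℕ σ) ≟ suc r) (risesℕ σ ≟ r) suc-injective (cong suc)) (sym (*-identityʳ (𝟙 (risesℕ σ ≟ r)))))))

  excessSplits-peel : ∀ n r u → excessSplits n r u ≡ atLeastSplits n r (suc u) + excessSplits n r (suc u)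
  excessSplits-peel n r u = trans
    (∑-cong (involutions132 n) (λ {σ} _ →
      trans (cong (𝟙 (risesℕ σ ≟ r) *_) (∸-peel (splitCount σ) u)) (*-distribˡ-+ (𝟙 (risesℕ σ ≟ r)) _ _)))
    (∑-+ _ _ (involutions132 n))

  excessSplits-vanishes : ∀ n r u → ⌊ n /2⌋ ≤ u → excessSplits n r u ≡ 0
  excessSplits-vanishes n r u ⌊n/2⌋≤u = ∑-zero (involutions132 n) (λ {σ} σ∈ →
    trans (cong (𝟙 (risesℕ σ ≟ r) *_) (m≤n⇒m∸n≡0 (≤-trans (few-splits σ∈) ⌊n/2⌋≤u))) (*-zeroʳ (𝟙 (risesℕ σ ≟ r))))
    where
      few-splits : ∀ {σ} → σ ∈ involutions132 n → splitCount σ ≤ ⌊ n /2⌋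
      few-splits {σ} σ∈ = subst (λ k → splitCount σ ≤ ⌊ k /2⌋) (IsInvolutionℕ.length≡ (member-involution n σ∈)) (splitCount≤ σ)

atLeastSplits≡formula : ∀ n r → atLeastSplits n r 0 ≡ atLeastSplitsFormula n r 0
atLeastSplits≡formula = SolveRecurrence.G≡formula atLeastSplits excessSplits
  (λ { zero → refl ; (suc r) → refl })
  (λ { zero → refl ; (suc r) → refl })
  (λ m u → atLeastSplits-suc-small m 0 u (s≤s z≤n))
  (λ m u → atLeastSplits-suc-small m 1 u ≤-refl)
  atLeastSplits-suc-2+ atLeastSplits-zero-0 atLeastSplits-zero-suc excessSplits-peel excessSplits-vanishes

toListℕ : ∀ {n k} → Vec (Fin n) k → List ℕ
toListℕ π = map toℕ (toList π)

length-toListℕ : ∀ {n k} (π : Vec (Fin n) k) → length (toListℕ π) ≡ k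
length-toListℕ []      = refl
length-toListℕ (x ∷ π) = cong suc (length-toListℕ π)

at-toListℕ : ∀ {n k} (π : Vec (Fin n) k) (i : Fin k) → at (toListℕ π) (toℕ i) ≡ toℕ (lookup π i)
at-toListℕ (x ∷ π) Fin.zero    = refl
at-toListℕ (x ∷ π) (Fin.suc i) = at-toListℕ π i

toListℕ-injective : ∀ {n k} {π π′ : Vec (Fin n) k} → toListℕ π ≡ toListℕ π′ → π ≡ π′
toListℕ-injective {π = []}    {[]}      _ = refl
toListℕ-injective {π = x ∷ π} {y ∷ π′} e = cong₂ _∷_ (toℕ-injective (∷-injectiveˡ e)) (toListℕ-injective (∷-injectiveʳ e))

toListℕ-surjective : ∀ {n} ℓ k → length ℓ ≡ k → (∀ {i} → i < k → at ℓ i < n) → Σ (Vec (Fin n) k) λ π → toListℕ π ≡ ℓ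
toListℕ-surjective []      zero    _ _       = [] , refl
toListℕ-surjective (x ∷ ℓ) (suc k) e bounded with toListℕ-surjective ℓ k (suc-injective e) (bounded ∘ s≤s)
... | π , refl = fromℕ< (bounded z<s) ∷ π , cong (_∷ toListℕ π) (toℕ-fromℕ< _)

rises≡risesℕ : ∀ {n} (π : Vec (Fin n) n) → rises π ≡ risesℕ (toListℕ π)
rises≡risesℕ π with toList π
... | []     = refl
... | x ∷ xs = risesFrom≡ x xs
  where
    riseAt≡ : ∀ {n} (x y : Fin n) → riseAt x y ≡ riseℕ (toℕ x) (toℕ y)
    riseAt≡ x y with toℕ x <? toℕ y
    ... | yes _ = refl
    ... | no  _ = refl
    risesFrom≡ : ∀ {n} (x : Fin n) xs → risesFrom x xs ≡ risesFromℕ (toℕ x) (map toℕ xs)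
    risesFrom≡ x []       = refl
    risesFrom≡ x (y ∷ xs) = cong₂ _+_ (riseAt≡ x y) (risesFrom≡ y xs)

module _ {n} (π : Vec (Fin n) n) where

  private
    at-fromℕ< : ∀ {i} (i<n : i < n) → at (toListℕ π) i ≡ toℕ (lookup π (fromℕ< i<n))
    at-fromℕ< i<n = trans (cong (at (toListℕ π)) (sym (toℕ-fromℕ< i<n))) (at-toListℕ π (fromℕ< i<n))

  involution⇒involutionℕ : IsInvolution π → IsInvolutionℕ n (toListℕ π)
  involution⇒involutionℕ inv = record
    { length≡    = length-toListℕ π
    ; bounded    = λ i<n → subst (_< n) (sym (at-fromℕ< i<n)) (toℕ<n _)
    ; involutive = involutive
    }
    where
      involutive : ∀ {i} → i < n → at (toListℕ π) (at (toListℕ π) i) ≡ i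
      involutive {i} i<n = begin
        at (toListℕ π) (at (toListℕ π) i)              ≡⟨ cong (at (toListℕ π)) (at-fromℕ< i<n) ⟩
        at (toListℕ π) (toℕ (lookup π (fromℕ< i<n)))   ≡⟨ at-toListℕ π _ ⟩
        toℕ (lookup π (lookup π (fromℕ< i<n)))         ≡⟨ cong toℕ (inv (fromℕ< i<n)) ⟩
        toℕ (fromℕ< i<n)                               ≡⟨ toℕ-fromℕ< i<n ⟩
        i                                              ∎
        where open ≡-Reasoning

  involutionℕ⇒involution : IsInvolutionℕ n (toListℕ π) → IsInvolution π
  involutionℕ⇒involution I i = toℕ-injective (begin
    toℕ (lookup π (lookup π i))                    ≡⟨ at-toListℕ π (lookup π i) ⟨
    at (toListℕ π) (toℕ (lookup π i))              ≡⟨ cong (at (toListℕ π)) (at-toListℕ π i) ⟨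
    at (toListℕ π) (at (toListℕ π) (toℕ i))        ≡⟨ IsInvolutionℕ.involutive I (toℕ<n i) ⟩
    toℕ i                                          ∎)
    where open ≡-Reasoning

  contains132⇒contains132ℕ : Contains132 π → Contains132ℕ n (toListℕ π)
  contains132⇒contains132ℕ (a , b , c , a<b , b<c , πa<πc , πc<πb) =
    toℕ a , toℕ b , toℕ c , a<b , b<c , toℕ<n c ,
    subst₂ _<_ (sym (at-toListℕ π a)) (sym (at-toListℕ π c)) πa<πc ,
    subst₂ _<_ (sym (at-toListℕ π c)) (sym (at-toListℕ π b)) πc<πb

  contains132ℕ⇒contains132 : Contains132ℕ n (toListℕ π) → Contains132 π
  contains132ℕ⇒contains132 (a , b , c , a<b , b<c , c<n , πa<πc , πc<πb) =
    fromℕ< a<n , fromℕ< b<n , fromℕ< c<n ,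
    subst₂ _<_ (sym (toℕ-fromℕ< a<n)) (sym (toℕ-fromℕ< b<n)) a<b ,
    subst₂ _<_ (sym (toℕ-fromℕ< b<n)) (sym (toℕ-fromℕ< c<n)) b<c ,
    subst₂ _<_ (at-fromℕ< a<n) (at-fromℕ< c<n) πa<πc ,
    subst₂ _<_ (at-fromℕ< c<n) (at-fromℕ< b<n) πc<πb
    where
      b<n = <-trans b<c c<n
      a<n = <-trans a<b b<n

∈-allVecs : ∀ n k (π : Vec (Fin n) k) → π ∈ allVecs n k
∈-allVecs n zero    []      = here refl
∈-allVecs n (suc k) (x ∷ π) = ∈-concat⁺′ (∈-map⁺ (x ∷_) (∈-allVecs n k π)) (∈-map⁺ (λ y → map (y ∷_) (allVecs n k)) (∈-allFin x))

allVecs-unique : ∀ n k → Unique (allVecs n k)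
allVecs-unique n zero    = All.[] AllPairs.∷ AllPairs.[]
allVecs-unique n (suc k) = Uniqueₚ.concat⁺
  (Allₚ.map⁺ (All.tabulate (λ _ → Uniqueₚ.map⁺ Vecₚ.∷-injectiveʳ (allVecs-unique n k))))
  (AllPairsₚ.map⁺ (AllPairs.map different-heads (Uniqueₚ.allFin⁺ n)))
  where
    different-heads : ∀ {x y} → x ≢ y → Disjoint (map (x ∷_) (allVecs n k)) (map (y ∷_) (allVecs n k))
    different-heads x≢y (π∈ , π∈′) with ∈-map⁻ (_ ∷_) π∈ | ∈-map⁻ (_ ∷_) π∈′
    ... | _ , _ , refl | _ , _ , e = x≢y (Vecₚ.∷-injectiveˡ e)

count≡atLeastSplits : ∀ n r → countInv132Rises n r ≡ atLeastSplits n r 0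
count≡atLeastSplits n r = begin
  length (filter (good? n r) (allVecs n n))                   ≡⟨ length-map toListℕ (filter (good? n r) (allVecs n n)) ⟨
  length (map toListℕ (filter (good? n r) (allVecs n n)))     ≡⟨ unique⇒length-≡ vecs-unique lists-unique vecs⊆lists lists⊆vecs ⟩
  length (filter (λ σ → risesℕ σ ≟ r) (involutions132 n))    ≡⟨ length-filter≡∑ (λ σ → risesℕ σ ≟ r) (involutions132 n) ⟩
  ∑ (λ σ → 𝟙 (risesℕ σ ≟ r)) (involutions132 n)               ≡⟨ ∑-cong (involutions132 n) (λ {σ} _ → *-identityʳ (𝟙 (risesℕ σ ≟ r))) ⟨
  atLeastSplits n r 0                                         ∎
  where
    open ≡-Reasoning

    vecs-unique : Unique (map toListℕ (filter (good? n r) (allVecs n n)))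
    vecs-unique = Uniqueₚ.map⁺ toListℕ-injective (Uniqueₚ.filter⁺ (good? n r) (allVecs-unique n n))

    lists-unique : Unique (filter (λ σ → risesℕ σ ≟ r) (involutions132 n))
    lists-unique = Uniqueₚ.filter⁺ (λ σ → risesℕ σ ≟ r) (involutions132-unique n)

    vecs⊆lists : ∀ {ℓ} → ℓ ∈ map toListℕ (filter (good? n r) (allVecs n n)) → ℓ ∈ filter (λ σ → risesℕ σ ≟ r) (involutions132 n)
    vecs⊆lists ℓ∈ with ∈-map⁻ toListℕ ℓ∈
    ... | π , π∈ , refl with ∈-filter⁻ (good? n r) {xs = allVecs n n} π∈
    ...   | _ , inv , av , rises≡r = ∈-filter⁺ (λ σ → risesℕ σ ≟ r)
            (involutions132-complete n (involution⇒involutionℕ π inv) (av ∘ contains132ℕ⇒contains132 π))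
            (trans (sym (rises≡risesℕ π)) rises≡r)

    lists⊆vecs : ∀ {ℓ} → ℓ ∈ filter (λ σ → risesℕ σ ≟ r) (involutions132 n) → ℓ ∈ map toListℕ (filter (good? n r) (allVecs n n))
    lists⊆vecs {ℓ} ℓ∈ with ∈-filter⁻ (λ σ → risesℕ σ ≟ r) {xs = involutions132 n} ℓ∈
    ... | ℓ∈′ , rises≡r with involutions132-sound n ℓ∈′
    ...   | I , av with toListℕ-surjective ℓ n (IsInvolutionℕ.length≡ I) (IsInvolutionℕ.bounded I)
    ...     | π , refl = ∈-map⁺ toListℕ (∈-filter⁺ (good? n r) (∈-allVecs n n π)
                           (involutionℕ⇒involution π I , av ∘ contains132⇒contains132ℕ π , trans (rises≡risesℕ π) rises≡r))

theorem2p4 : (n r : ℕ) → n ≥ 1 →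
    countInv132Rises n r ≡ ((n / 2) C ((r + 1) / 2)) * (((n ∸ 1) / 2) C (r / 2))
theorem2p4 n r _ = begin
  countInv132Rises n r                                  ≡⟨ count≡atLeastSplits n r ⟩
  atLeastSplits n r 0                                   ≡⟨ atLeastSplits≡formula n r ⟩
  (⌊ n /2⌋ C ⌊ suc r /2⌋) * (⌊ n ∸ 1 /2⌋ C ⌊ r /2⌋)
    ≡⟨ cong₂ _*_ (cong₂ _C_ (⌊n/2⌋≡n/2 n) (trans (⌊n/2⌋≡n/2 (suc r)) (cong (_/ 2) (+-comm 1 r))))
                 (cong₂ _C_ (⌊n/2⌋≡n/2 (n ∸ 1)) (⌊n/2⌋≡n/2 r)) ⟩
  ((n / 2) C ((r + 1) / 2)) * (((n ∸ 1) / 2) C (r / 2)) ∎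
  where open ≡-Reasoning
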